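{- Fix a labeling of the infinite rooted binary tree $T_\infty$ with root $x_0$, an integer $\ell\geq2$ and an integer $n\geq0$. Define $\psi_n:M_{\ell,n}\to\{\pm1\}^n$ by $\psi_n(\sigma)=(e_1,\dots,e_n)$, where $e_i=\operatorname{sgn}_i(\sigma,x_0)$ if $1\le i\le\ell-1$; $e_i=+1$ if $i\geq\ell$ and $\sigma$ is an $(\ell,i)$-even cousins map above $x_0$; and $e_i=-1$ if $i\ge\ell$ and $\sigma$ is an $(\ell,i)$-odd cousins map above $x_0$. Then $\psi_n$ is a surjective group homomorphism and $\ker\psi_n$ is the commutator subgroup of $M_{\ell,n}$. In particular, the abelianization of $M_{\ell,n}$ is isomorphic to $\{\pm1\}^n$.
   Context: $T_n$ is the subtree of levels $0,\dots,n$. A labeling assigns to each node at level $m$ a word in $\{0,1\}^m$, bijectively per level, with children of $w$ labeled $w0,w1$. For a tree automorphism $\sigma$, node $y$, $m\geq1$: $\sigma$ sends the node $ys_1\dots s_m$ to $\sigma(y)t_1\dots t_m$, and $\operatorname{sgn}_m(\sigma,y)$ is the sign of the permutation $(s_i)\mapsto(t_i)$ of $\{0,1\}^m$. $M_\ell$ is the set of $\sigma\in\operatorname{Aut}(T_\infty)$ with $\operatorname{sgn}_\ell(\sigma,y)=+1$ for every node $y$, and $M_{\ell,n}$ is the group of restrictions of elements of $M_\ell$ to $T_n$. For $\sigma\in M_{\ell,n}$ and a node $w$ with children $y_0,y_1$, $\sigma$ acts $\ell$-negatively above $w$ if $\operatorname{sgn}_{\ell-1}(\sigma,y_0)=\operatorname{sgn}_{\ell-1}(\sigma,y_1)=-1$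 (these two signs are always equal for such $\sigma$). For $\ell\le i\le n$ and a node $x$, $\sigma$ is an $(\ell,i)$-odd cousins map above $x$ if the number of nodes $w$ lying $i-\ell$ levels above $x$ above which $\sigma$ acts $\ell$-negatively is odd, and an $(\ell,i)$-even cousins map otherwise. -}

module Defs where

open import Data.Bool using (Bool; true; false; if_then_else_; _∧_)
import Data.Nat
open import Data.Nat using (ℕ; zero; suc; _+_; _∸_; _^_; _≤_; _<ᵇ_)
open import Data.Nat.ListAction using (sum)
open import Data.List using (List; []; _∷_; map) renaming (_++_ to _++ˡ_)
open import Data.Vec using (Vec; []; _∷_; _++_; drop; init; _∷ʳ_; tabulate)
open import Data.Fin using (Fin; toℕ)
open import Data.Sign using (Sign; -; opposite) renaming (+ to ⊕)
open import Data.Product using (_×_; _,_; Σ)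
open import Relation.Binary.PropositionalEquality using (_≡_; refl; trans; cong; sym)

-- The infinite rooted binary tree T_∞ with its (canonical) labeling:
-- the nodes at level m are the words in {0,1}^m = Vec Bool m
-- (false = 0, true = 1); the root x₀ is the empty word [];
-- the children of w are w ∷ʳ false and w ∷ʳ true, the parent of a
-- node at level m+1 is obtained by deleting the last letter (init).

Word : ℕ → Set
Word m = Vec Bool m

-- A tree automorphism of T_∞: a bijection of each level, commuting
-- with the parent map (hence preserving the root and all edges).
record TreeAut : Set where
  field
    f       : ∀ m → Word m → Word m
    g       : ∀ m → Word m → Word m
    f∘g     : ∀ m w → f m (g m w) ≡ w
    g∘f     : ∀ m w → g m (f m w) ≡ w
    parent  : ∀ m (w : Word (suc m)) → init (f (suc m) w) ≡ f m (init w)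
open TreeAut public

idAut : TreeAut
idAut = record
  { f = λ _ w → w ; g = λ _ w → w
  ; f∘g = λ _ _ → refl ; g∘f = λ _ _ → refl ; parent = λ _ _ → refl }

-- Composition: (σ ∘ᵀ τ) acts as τ first, then σ.
_∘ᵀ_ : TreeAut → TreeAut → TreeAut
σ ∘ᵀ τ = record
  { f = λ m w → f σ m (f τ m w)
  ; g = λ m w → g τ m (g σ m w)
  ; f∘g = λ m w → trans (cong (f σ m) (f∘g τ m (g σ m w))) (f∘g σ m w)
  ; g∘f = λ m w → trans (cong (g τ m) (g∘f σ m (f τ m w))) (g∘f τ m w)
  ; parent = λ m w → trans (parent σ m (f τ (suc m) w)) (cong (f σ m) (parent τ m w))
  }

_⁻¹ᵀ : TreeAut → TreeAut
σ ⁻¹ᵀ = record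
  { f = g σ ; g = f σ ; f∘g = g∘f σ ; g∘f = f∘g σ
  ; parent = λ m v →
      trans (sym (g∘f σ m (init (g σ (suc m) v))))
            (cong (g σ m) (trans (sym (parent σ m (g σ (suc m) v)))
                                 (cong init (f∘g σ (suc m) v))))
  }

[_,_]ᵀ : TreeAut → TreeAut → TreeAut
[ a , b ]ᵀ = (a ⁻¹ᵀ) ∘ᵀ ((b ⁻¹ᵀ) ∘ᵀ (a ∘ᵀ b))

_≈[_]_ : TreeAut → ℕ → TreeAut → Set
σ ≈[ n ] τ = ∀ m → m ≤ n → ∀ (w : Word m) → f σ m w ≡ f τ m w

-- Sign of a permutation of {0,1}^m, defined as (-1)^(number of
-- inversions) w.r.t. the order of {0,1}^m given by reading words as
-- binary numbers (first letter most significant).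

parity : ℕ → Sign
parity zero    = ⊕
parity (suc k) = opposite (parity k)

allWords : ∀ m → List (Word m)
allWords zero    = [] ∷ []
allWords (suc m) = map (false ∷_) (allWords m) ++ˡ map (true ∷_) (allWords m)

code : ∀ {m} → Word m → ℕ
code {zero}  []      = 0
code {suc m} (b ∷ w) = (if b then 2 ^ m else 0) + code w

inversions : ∀ {m} → (Word m → Word m) → ℕ
inversions {m} π =
  sum (map (λ u → sum (map (λ v →
        if (code u <ᵇ code v) ∧ (code (π v) <ᵇ code (π u)) then 1 else 0)
      (allWords m))) (allWords m))

permSign : ∀ {m} → (Word m → Word m) → Sign
permSign π = parity (inversions π)

-- sgn_m(σ, y): σ sends y s₁…s_m to σ(y) t₁…t_m; this is the sign of
-- the permutation (s_i) ↦ (t_i) of {0,1}^m.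

localPerm : TreeAut → ∀ m {k} → Word k → Word m → Word m
localPerm σ m {k} y s = drop k (f σ (k + m) (y ++ s))

sgn : ∀ m → TreeAut → ∀ {k} → Word k → Sign
sgn m σ y = permSign (localPerm σ m y)

InM : ℕ → TreeAut → Set
InM ℓ σ = ∀ k (y : Word k) → sgn ℓ σ y ≡ ⊕

isMinus : Sign → Bool
isMinus - = true
isMinus ⊕ = false

actsNeg : ℕ → TreeAut → ∀ {k} → Word k → Bool
actsNeg ℓ σ w = isMinus (sgn (ℓ ∸ 1) σ (w ∷ʳ false)) ∧ isMinus (sgn (ℓ ∸ 1) σ (w ∷ʳ true))

negCount : ℕ → ℕ → TreeAut → ∀ {k} → Word k → ℕ
negCount ℓ i σ x =
  sum (map (λ s → if actsNeg ℓ σ (x ++ s) then 1 else 0) (allWords (i ∸ ℓ)))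

OddCousins : ℕ → ℕ → TreeAut → ∀ {k} → Word k → Set
OddCousins ℓ i σ x = parity (negCount ℓ i σ x) ≡ -

EvenCousins : ℕ → ℕ → TreeAut → ∀ {k} → Word k → Set
EvenCousins ℓ i σ x = parity (negCount ℓ i σ x) ≡ ⊕

cousinSign : ℕ → ℕ → TreeAut → ∀ {k} → Word k → Sign
cousinSign ℓ i σ x = parity (negCount ℓ i σ x)

-- ψ_n(σ) = (e_1, …, e_n); the Fin n index j stands for i = j + 1.

x₀ : Word 0
x₀ = []

ψ : ℕ → (n : ℕ) → TreeAut → Vec Sign n
ψ ℓ n σ = tabulate λ (j : Fin n) →
  let i = suc (toℕ j) in
  if i <ᵇ ℓ then sgn i σ x₀ else cousinSign ℓ i σ x₀

-- Elements of M_{ℓ,n} are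
-- represented by elements of M_ℓ, up to equal restriction to T_n.

data InCommutator (ℓ n : ℕ) : TreeAut → Set where
  gen  : ∀ a b σ → InM ℓ a → InM ℓ b → σ ≈[ n ] [ a , b ]ᵀ → InCommutator ℓ n σ
  unit : ∀ σ → σ ≈[ n ] idAut → InCommutator ℓ n σ
  mul  : ∀ a b σ → InCommutator ℓ n a → InCommutator ℓ n b →
         σ ≈[ n ] (a ∘ᵀ b) → InCommutator ℓ n σ
  inv  : ∀ a σ → InCommutator ℓ n a → σ ≈[ n ] (a ⁻¹ᵀ) → InCommutator ℓ n σ

{-# OPTIONS --safe #-}
-- An automorphism is determined by its portrait, the set of letters it flips, and
-- sgn_m(σ, y) is the parity of the flips of σ on the last of the m levels below y.
-- Through this parity every coordinate of ψ becomes additive on M_ℓ (the cocycle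
-- correction vanishes by the defining condition of M_ℓ), so ψ is a homomorphism to an
-- abelian group and kills commutators. Conversely, σ agrees on T_n with the product of
-- its level slices, and a slice with vanishing coordinate is a sum, over F₂, of
-- commutators of a one-letter flip below a prefix (or of a pair of such flips in one
-- subtree of height ℓ − 1) with the slice of one or two δ-functions. For surjectivity
-- flip, on each level with e_i = −1, the node 0…0 or a pair of cousins 0…0 c 0…0.
module Submission where

open import Defs
open import Algebra using (CommutativeRing)
open import Data.Bool using (Bool; true; false; if_then_else_; _∧_; not; _xor_; T)
import Data.Bool as Bool
open import Data.Bool.Properties
  using (xor-assoc; xor-comm; xor-same; xor-identityʳ; not-involutive; not-distribˡ-xor; ¬-not; not-¬;
         ∧-assoc; ∧-comm; ∧-idem; ∧-zeroʳ; ∧-identityʳ; ∧-distribˡ-xor; ∧-distribʳ-xor;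
         T-≡; if-float; xor-∧-commutativeRing)
open import Data.Empty using (⊥-elim)
open import Data.Fin using (Fin; toℕ; _↑ʳ_; _↑ˡ_)
import Data.Fin as Fin
import Data.Fin.Properties as FinP
open import Data.List using (List; []; _∷_; map) renaming (_++_ to _++ˡ_)
open import Data.Nat using (ℕ; zero; suc; _+_; _∸_; _^_; _≤_; _<_; _<ᵇ_; _≡ᵇ_; z≤n; s≤s)
open import Data.Nat.ListAction using (sum)
import Data.Nat.Properties as ℕ
open import Data.Product using (_×_; _,_; ∃)
open import Data.Sign using (Sign; -; _*_) renaming (+ to ⊕)
open import Data.Vec
  using (Vec; []; _∷_; _++_; drop; init; last; _∷ʳ_; initLast; tabulate; zipWith; replicate; lookup)
import Data.Vec.Properties as Vec
open import Function using (_∘_; Equivalence)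
open import Function.Bundles using (_⇔_; mk⇔)
open import Relation.Binary.Definitions using (Reflexive; Transitive; tri<; tri≈; tri>)
open import Relation.Binary.PropositionalEquality
open import Relation.Nullary using (¬_; Dec; yes; no; does)
open import Relation.Nullary.Decidable using (dec-true; dec-false)
open import Algebra.Properties.CommutativeSemigroup
  (CommutativeRing.+-commutativeSemigroup xor-∧-commutativeRing) using (interchange; xy∙z≈xz∙y)

bitSign : Bool → Sign
bitSign false = ⊕
bitSign true  = -

bitSign-xor : ∀ a b → bitSign (a xor b) ≡ bitSign a * bitSign b
bitSign-xor false b     = refl
bitSign-xor true  false = refl
bitSign-xor true  true  = refl

bitSign-isMinus : ∀ s → bitSign (isMinus s) ≡ s
bitSign-isMinus - = refl
bitSign-isMinus ⊕ = refl

isMinus-bitSign : ∀ b → isMinus (bitSign b) ≡ b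
isMinus-bitSign false = refl
isMinus-bitSign true  = refl

bitSign≡⊕⇒false : ∀ {b} → bitSign b ≡ ⊕ → b ≡ false
bitSign≡⊕⇒false {false} _ = refl

odd : ℕ → Bool
odd zero    = false
odd (suc k) = not (odd k)

parity≡bitSign-odd : ∀ k → parity k ≡ bitSign (odd k)
parity≡bitSign-odd zero    = refl
parity≡bitSign-odd (suc k) rewrite parity≡bitSign-odd k with odd k
... | false = refl
... | true  = refl

odd-+ : ∀ a b → odd (a + b) ≡ odd a xor odd b
odd-+ zero    b = refl
odd-+ (suc a) b = trans (cong not (odd-+ a b)) (not-distribˡ-xor (odd a) (odd b))

odd-if : ∀ b → odd (if b then 1 else 0) ≡ b
odd-if false = refl
odd-if true  = refl

xor-cancelʳ : ∀ a b → (a xor b) xor b ≡ a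
xor-cancelʳ a b = trans (xor-assoc a b b) (trans (cong (a xor_) (xor-same b)) (xor-identityʳ a))

xor-cancel-middle : ∀ x y z → (x xor y) xor (z xor y) ≡ x xor z
xor-cancel-middle x y z =
  trans (interchange x y z y) (trans (cong ((x xor z) xor_) (xor-same y)) (xor-identityʳ (x xor z)))

xor≡false⇒≡ : ∀ {a b} → a xor b ≡ false → a ≡ b
xor≡false⇒≡ {false} {false} _ = refl
xor≡false⇒≡ {true}  {true}  _ = refl

xorSum : {A : Set} → List A → (A → Bool) → Bool
xorSum []       h = false
xorSum (a ∷ as) h = h a xor xorSum as h

syntax xorSum xs (λ x → e) = ⨁[ x ∈ xs ] e

module _ {A : Set} where

  xorSum-cong : ∀ (xs : List A) {h h′ : A → Bool} → (∀ a → h a ≡ h′ a) → xorSum xs h ≡ xorSum xs h′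
  xorSum-cong []       e = refl
  xorSum-cong (x ∷ xs) e = cong₂ _xor_ (e x) (xorSum-cong xs e)

  xorSum-++ : ∀ (xs ys : List A) h → xorSum (xs ++ˡ ys) h ≡ xorSum xs h xor xorSum ys h
  xorSum-++ []       ys h = refl
  xorSum-++ (x ∷ xs) ys h =
    trans (cong (h x xor_) (xorSum-++ xs ys h)) (sym (xor-assoc (h x) (xorSum xs h) (xorSum ys h)))

  xorSum-map : ∀ {B : Set} (g : A → B) xs h → xorSum (map g xs) h ≡ xorSum xs (h ∘ g)
  xorSum-map g []       h = refl
  xorSum-map g (x ∷ xs) h = cong (h (g x) xor_) (xorSum-map g xs h)

  xorSum-xor : ∀ (xs : List A) h h′ → (⨁[ a ∈ xs ] (h a xor h′ a)) ≡ xorSum xs h xor xorSum xs h′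
  xorSum-xor []       h h′ = refl
  xorSum-xor (x ∷ xs) h h′ =
    trans (cong ((h x xor h′ x) xor_) (xorSum-xor xs h h′)) (interchange (h x) (h′ x) _ _)

  xorSum-zero : ∀ (xs : List A) h → (∀ a → h a ≡ false) → xorSum xs h ≡ false
  xorSum-zero []       h e = refl
  xorSum-zero (x ∷ xs) h e rewrite e x = xorSum-zero xs h e

  xorSum-∧ˡ : ∀ (xs : List A) b h → (⨁[ a ∈ xs ] (b ∧ h a)) ≡ b ∧ xorSum xs h
  xorSum-∧ˡ xs false h = xorSum-zero xs _ λ _ → refl
  xorSum-∧ˡ xs true  h = refl

  xorSum-∧ʳ : ∀ (xs : List A) h b → (⨁[ a ∈ xs ] (h a ∧ b)) ≡ xorSum xs h ∧ b
  xorSum-∧ʳ xs h false = trans (xorSum-zero xs _ (∧-zeroʳ ∘ h)) (sym (∧-zeroʳ _))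
  xorSum-∧ʳ xs h true  = trans (xorSum-cong xs (∧-identityʳ ∘ h)) (sym (∧-identityʳ _))

  odd-sum : ∀ (xs : List A) (F : A → ℕ) → odd (sum (map F xs)) ≡ xorSum xs (odd ∘ F)
  odd-sum []       F = refl
  odd-sum (x ∷ xs) F = trans (odd-+ (F x) _) (cong (odd (F x) xor_) (odd-sum xs F))

⨁-allWords-suc : ∀ m h → xorSum (allWords (suc m)) h ≡
  (⨁[ t ∈ allWords m ] h (false ∷ t)) xor (⨁[ t ∈ allWords m ] h (true ∷ t))
⨁-allWords-suc m h = trans (xorSum-++ (map (false ∷_) (allWords m)) _ h)
  (cong₂ _xor_ (xorSum-map (false ∷_) (allWords m) h) (xorSum-map (true ∷_) (allWords m) h))

⨁-allWords-+ : ∀ k m h →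
  xorSum (allWords (k + m)) h ≡ (⨁[ y ∈ allWords k ] (⨁[ t ∈ allWords m ] h (y ++ t)))
⨁-allWords-+ zero    m h = sym (xor-identityʳ _)
⨁-allWords-+ (suc k) m h = trans (⨁-allWords-suc (k + m) h)
  (trans (cong₂ _xor_ (⨁-allWords-+ k m (h ∘ (false ∷_))) (⨁-allWords-+ k m (h ∘ (true ∷_))))
    (sym (⨁-allWords-suc k _)))

⨁-allWords-∷ʳ : ∀ j h →
  xorSum (allWords (suc j)) h ≡ (⨁[ w ∈ allWords j ] (h (w ∷ʳ false) xor h (w ∷ʳ true)))
⨁-allWords-∷ʳ zero    h = sym (xor-assoc (h (false ∷ [])) (h (true ∷ [])) false)
⨁-allWords-∷ʳ (suc j) h = trans (⨁-allWords-suc (suc j) h)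
  (trans (cong₂ _xor_ (⨁-allWords-∷ʳ j (h ∘ (false ∷_))) (⨁-allWords-∷ʳ j (h ∘ (true ∷_))))
    (sym (⨁-allWords-suc j _)))

⨁-allWords-const : ∀ m a → (⨁[ _ ∈ allWords m ] a) ≡ (m ≡ᵇ 0) ∧ a
⨁-allWords-const zero    a = xor-identityʳ a
⨁-allWords-const (suc m) a = trans (⨁-allWords-suc m (λ _ → a)) (xor-same (⨁[ _ ∈ allWords m ] a))

_≟ᵂ_ : ∀ {m} (u v : Word m) → Dec (u ≡ v)
_≟ᵂ_ = Vec.≡-dec Bool._≟_

infix 4.5 _==_

_==_ : ∀ {m} → Word m → Word m → Bool
u == v = does (u ≟ᵂ v)

==-refl : ∀ {m} (u : Word m) → u == u ≡ true
==-refl u = dec-true (u ≟ᵂ u) refl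

==-⇔ : ∀ {m m′} {u v : Word m} {u′ v′ : Word m′} →
       (u ≡ v → u′ ≡ v′) → (u′ ≡ v′ → u ≡ v) → u == v ≡ u′ == v′
==-⇔ {u = u} {v} {u′} {v′} to from with u ≟ᵂ v
... | yes e = sym (dec-true (u′ ≟ᵂ v′) (to e))
... | no ¬e = sym (dec-false (u′ ≟ᵂ v′) (¬e ∘ from))

==-sym : ∀ {m} (u v : Word m) → u == v ≡ v == u
==-sym u v = ==-⇔ {u = u} {v} {v} {u} sym sym

==-++ : ∀ {k m} (z w : Word k) (s t : Word m) → (z ++ s) == (w ++ t) ≡ (z == w) ∧ (s == t)
==-++ z w s t with z ≟ᵂ w
... | yes refl = ==-⇔ (Vec.++-injectiveʳ z z) (cong (z ++_))
... | no z≢w   = dec-false ((z ++ s) ≟ᵂ (w ++ t)) (z≢w ∘ Vec.++-injectiveˡ z w)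

⨁-allWords-δ : ∀ m (F : Word m → Bool) v → (⨁[ u ∈ allWords m ] (F u ∧ (v == u))) ≡ F v
⨁-allWords-δ zero    F [] = trans (xor-identityʳ _) (∧-identityʳ (F []))
⨁-allWords-δ (suc m) F (b ∷ v) = trans (⨁-allWords-suc m _) (split b)
  where
  same : ∀ c → (⨁[ u ∈ allWords m ] (F (c ∷ u) ∧ ((c ∷ v) == (c ∷ u)))) ≡ F (c ∷ v)
  same c = trans (xorSum-cong (allWords m) λ u → cong (F (c ∷ u) ∧_) (==-++ (c ∷ []) (c ∷ []) v u))
    (trans (xorSum-cong (allWords m) λ u → cong (λ e → F (c ∷ u) ∧ (e ∧ (v == u))) (==-refl (c ∷ [])))
      (⨁-allWords-δ m (F ∘ (c ∷_)) v))
  other : ∀ c d → ¬ c ≡ d → (⨁[ u ∈ allWords m ] (F (d ∷ u) ∧ ((c ∷ v) == (d ∷ u)))) ≡ false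
  other c d c≢d = xorSum-zero (allWords m) _ λ u →
    trans (cong (F (d ∷ u) ∧_) (dec-false ((c ∷ v) ≟ᵂ (d ∷ u)) (c≢d ∘ Vec.∷-injectiveˡ))) (∧-zeroʳ _)
  split : ∀ b → (⨁[ u ∈ allWords m ] (F (false ∷ u) ∧ ((b ∷ v) == (false ∷ u)))) xor
                (⨁[ u ∈ allWords m ] (F (true ∷ u) ∧ ((b ∷ v) == (true ∷ u)))) ≡ F (b ∷ v)
  split false = trans (cong₂ _xor_ (same false) (other false true λ ())) (xor-identityʳ _)
  split true  = cong₂ _xor_ (other true false λ ()) (same true)

⨁-allWords-== : ∀ m (v : Word m) → (⨁[ u ∈ allWords m ] (u == v)) ≡ true
⨁-allWords-== m v = trans (xorSum-cong (allWords m) λ u → ==-sym u v) (⨁-allWords-δ m (λ _ → true) v)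

⨁-==-++ : ∀ {k} m (z w : Word k) (s₀ : Word m) → (⨁[ s ∈ allWords m ] ((z ++ s) == (w ++ s₀))) ≡ z == w
⨁-==-++ m z w s₀ = trans (xorSum-cong (allWords m) λ s → ==-++ z w s s₀)
  (trans (xorSum-∧ˡ (allWords m) (z == w) (_== s₀)) (trans (cong ((z == w) ∧_) (⨁-allWords-== m s₀)) (∧-identityʳ _)))

-- Portraits

-- p k v says whether the letter following the prefix v (of length k) is flipped.
Portrait : Set
Portrait = (k : ℕ) → Word k → Bool

_≗ᵖ_ : Portrait → Portrait → Set
p ≗ᵖ q = ∀ k u → p k u ≡ q k u

_↾₁_ : Portrait → Bool → Portrait
(p ↾₁ b) k u = p (suc k) (b ∷ u)

_↾_ : ∀ {k} → Portrait → Word k → Portrait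
p ↾ []      = p
p ↾ (b ∷ y) = (p ↾₁ b) ↾ y

↾-++ : ∀ {k} p (y : Word k) m t → (p ↾ y) m t ≡ p (k + m) (y ++ t)
↾-++ p []      m t = refl
↾-++ p (b ∷ y) m t = ↾-++ (p ↾₁ b) y m t

↾-∷ʳ : ∀ p {k} (v : Word k) b m t → (p ↾ (v ∷ʳ b)) m t ≡ (p ↾ v) (suc m) (b ∷ t)
↾-∷ʳ p []      b m t = refl
↾-∷ʳ p (c ∷ v) b m t = ↾-∷ʳ (p ↾₁ c) v b m t

↾-cong : ∀ {p q} → p ≗ᵖ q → ∀ {k} (y : Word k) → (p ↾ y) ≗ᵖ (q ↾ y)
↾-cong e []      = e
↾-cong e (b ∷ y) = ↾-cong (λ k u → e (suc k) (b ∷ u)) y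

act : Portrait → ∀ k → Word k → Word k
act p zero    []      = []
act p (suc k) (b ∷ w) = (b xor p 0 []) ∷ act (p ↾₁ b) k w

act⁻¹ : Portrait → ∀ k → Word k → Word k
act⁻¹ p zero    []      = []
act⁻¹ p (suc k) (c ∷ w) = (c xor p 0 []) ∷ act⁻¹ (p ↾₁ (c xor p 0 [])) k w

act-act⁻¹ : ∀ p k w → act p k (act⁻¹ p k w) ≡ w
act-act⁻¹ p zero    []      = refl
act-act⁻¹ p (suc k) (c ∷ w) =
  cong₂ _∷_ (xor-cancelʳ c (p 0 [])) (act-act⁻¹ (p ↾₁ (c xor p 0 [])) k w)

act⁻¹-act : ∀ p k w → act⁻¹ p k (act p k w) ≡ w
act⁻¹-act p zero    []      = refl
act⁻¹-act p (suc k) (b ∷ w) rewrite xor-cancelʳ b (p 0 []) = cong (b ∷_) (act⁻¹-act (p ↾₁ b) k w)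

act-cong : ∀ {p q} → p ≗ᵖ q → ∀ k w → act p k w ≡ act q k w
act-cong e zero    []      = refl
act-cong e (suc k) (b ∷ w) = cong₂ _∷_ (cong (b xor_) (e 0 [])) (act-cong (λ k u → e (suc k) (b ∷ u)) k w)

act-∷ʳ : ∀ p k (v : Word k) b → act p (suc k) (v ∷ʳ b) ≡ act p k v ∷ʳ (b xor p k v)
act-∷ʳ p zero    []      b = refl
act-∷ʳ p (suc k) (c ∷ v) b = cong ((c xor p 0 []) ∷_) (act-∷ʳ (p ↾₁ c) k v b)

act-++ : ∀ p {k} (y : Word k) {m} (s : Word m) → act p (k + m) (y ++ s) ≡ act p k y ++ act (p ↾ y) m s
act-++ p []      s = refl
act-++ p (b ∷ y) s = cong ((b xor p 0 []) ∷_) (act-++ (p ↾₁ b) y s)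

init∷ʳlast : ∀ {n} (w : Word (suc n)) → w ≡ init w ∷ʳ last w
init∷ʳlast w with initLast w
... | _ , _ , refl = refl

init-act : ∀ p k w → init (act p (suc k) w) ≡ act p k (init w)
init-act p k w = trans (cong (init ∘ act p (suc k)) (init∷ʳlast w))
  (trans (cong init (act-∷ʳ p k (init w) (last w))) (Vec.init-∷ʳ _ (act p k (init w))))

fromPortrait : Portrait → TreeAut
fromPortrait p = record
  { f = act p ; g = act⁻¹ p ; f∘g = act-act⁻¹ p ; g∘f = act⁻¹-act p ; parent = init-act p }

portrait : TreeAut → Portrait
portrait σ k v = last (f σ (suc k) (v ∷ʳ false))

f-∷ʳ : ∀ σ k (v : Word k) b → f σ (suc k) (v ∷ʳ b) ≡ f σ k v ∷ʳ (b xor portrait σ k v)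
f-∷ʳ σ k v b = trans (init∷ʳlast _) (cong₂ _∷ʳ_ (init-f b) (last-f b))
  where
  init-f : ∀ b → init (f σ (suc k) (v ∷ʳ b)) ≡ f σ k v
  init-f b = trans (parent σ k (v ∷ʳ b)) (cong (f σ k) (Vec.init-∷ʳ b v))
  last-f : ∀ b → last (f σ (suc k) (v ∷ʳ b)) ≡ b xor portrait σ k v
  last-f false = refl
  last-f true  = ¬-not λ same-last → true≢false (Vec.∷ʳ-injectiveʳ v v (begin
      v ∷ʳ true                                       ≡⟨ g∘f σ (suc k) _ ⟨
      g σ (suc k) (f σ (suc k) (v ∷ʳ true))           ≡⟨ cong (g σ (suc k)) (trans (init∷ʳlast _)
                                                           (cong₂ _∷ʳ_ (trans (init-f true) (sym (init-f false))) same-last)) ⟩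
      g σ (suc k) (init (f σ (suc k) (v ∷ʳ false)) ∷ʳ portrait σ k v)
                                                      ≡⟨ cong (g σ (suc k)) (init∷ʳlast _) ⟨
      g σ (suc k) (f σ (suc k) (v ∷ʳ false))          ≡⟨ g∘f σ (suc k) _ ⟩
      v ∷ʳ false                                      ∎))
    where
    open ≡-Reasoning
    true≢false : true ≢ false
    true≢false ()

f≗act-portrait : ∀ σ k w → f σ k w ≡ act (portrait σ) k w
f≗act-portrait σ zero    []  with f σ 0 []
... | [] = refl
f≗act-portrait σ (suc k) w = begin
  f σ (suc k) w                                   ≡⟨ cong (f σ (suc k)) (init∷ʳlast w) ⟩
  f σ (suc k) (init w ∷ʳ last w)                  ≡⟨ f-∷ʳ σ k (init w) (last w) ⟩
  f σ k (init w) ∷ʳ (last w xor portrait σ k (init w))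
                                                  ≡⟨ cong (_∷ʳ (last w xor portrait σ k (init w))) (f≗act-portrait σ k (init w)) ⟩
  act (portrait σ) k (init w) ∷ʳ (last w xor portrait σ k (init w))
                                                  ≡⟨ act-∷ʳ (portrait σ) k (init w) (last w) ⟨
  act (portrait σ) (suc k) (init w ∷ʳ last w)     ≡⟨ cong (act (portrait σ) (suc k)) (init∷ʳlast w) ⟨
  act (portrait σ) (suc k) w                      ∎
  where open ≡-Reasoning

portrait-unique : ∀ σ p → (∀ k w → f σ k w ≡ act p k w) → portrait σ ≗ᵖ p
portrait-unique σ p e k v =
  trans (cong last (trans (e (suc k) (v ∷ʳ false)) (act-∷ʳ p k v false))) (Vec.last-∷ʳ _ (act p k v))

portrait-fromPortrait : ∀ p → portrait (fromPortrait p) ≗ᵖ p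
portrait-fromPortrait p = portrait-unique (fromPortrait p) p λ _ _ → refl

_∙ᵖ_ : Portrait → Portrait → Portrait
(q ∙ᵖ r) k u = r k u xor q k (act r k u)

act-∙ᵖ : ∀ q r k w → act (q ∙ᵖ r) k w ≡ act q k (act r k w)
act-∙ᵖ q r zero    []      = refl
act-∙ᵖ q r (suc k) (b ∷ w) =
  cong₂ _∷_ (sym (xor-assoc b (r 0 []) (q 0 []))) (act-∙ᵖ (q ↾₁ (b xor r 0 [])) (r ↾₁ b) k w)

↾-∙ᵖ : ∀ q r {k} (y : Word k) → ((q ∙ᵖ r) ↾ y) ≗ᵖ ((q ↾ act r k y) ∙ᵖ (r ↾ y))
↾-∙ᵖ q r []      m t = refl
↾-∙ᵖ q r (b ∷ y) m t = ↾-∙ᵖ (q ↾₁ (b xor r 0 [])) (r ↾₁ b) y m t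

portrait-∘ᵀ : ∀ σ τ → portrait (σ ∘ᵀ τ) ≗ᵖ (portrait σ ∙ᵖ portrait τ)
portrait-∘ᵀ σ τ = portrait-unique (σ ∘ᵀ τ) _ λ k w →
  trans (trans (cong (f σ k) (f≗act-portrait τ k w)) (f≗act-portrait σ k _))
        (sym (act-∙ᵖ (portrait σ) (portrait τ) k w))

portrait-idAut : portrait idAut ≗ᵖ (λ _ _ → false)
portrait-idAut k v = Vec.last-∷ʳ false v

_⁻¹ᵖ : Portrait → Portrait
(p ⁻¹ᵖ) k v = p k (act⁻¹ p k v)

act-⁻¹ᵖ : ∀ p k w → act (p ⁻¹ᵖ) k w ≡ act⁻¹ p k w
act-⁻¹ᵖ p zero    []      = refl
act-⁻¹ᵖ p (suc k) (c ∷ w) = cong ((c xor p 0 []) ∷_) (act-⁻¹ᵖ (p ↾₁ (c xor p 0 [])) k w)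

-- A sum over a level is invariant under a tree automorphism: going one level
-- down, act either fixes or swaps the two children of each node.
⨁-allWords-act : ∀ j q h → (⨁[ w ∈ allWords j ] h (act q j w)) ≡ xorSum (allWords j) h
⨁-allWords-act zero    q h = refl
⨁-allWords-act (suc j) q h = begin
  (⨁[ w ∈ allWords (suc j) ] h (act q (suc j) w))
    ≡⟨ ⨁-allWords-∷ʳ j (h ∘ act q (suc j)) ⟩
  (⨁[ w ∈ allWords j ] (h (act q (suc j) (w ∷ʳ false)) xor h (act q (suc j) (w ∷ʳ true))))
    ≡⟨ xorSum-cong (allWords j) children ⟩
  (⨁[ w ∈ allWords j ] H (act q j w))
    ≡⟨ ⨁-allWords-act j q H ⟩
  xorSum (allWords j) H
    ≡⟨ ⨁-allWords-∷ʳ j h ⟨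
  xorSum (allWords (suc j)) h ∎
  where
  open ≡-Reasoning
  H : Word j → Bool
  H v = h (v ∷ʳ false) xor h (v ∷ʳ true)
  children : ∀ w → h (act q (suc j) (w ∷ʳ false)) xor h (act q (suc j) (w ∷ʳ true)) ≡ H (act q j w)
  children w rewrite act-∷ʳ q j w false | act-∷ʳ q j w true with q j w
  ... | false = refl
  ... | true  = xor-comm (h (act q j w ∷ʳ true)) (h (act q j w ∷ʳ false))

-- Signs of tree permutations

<⇒<ᵇ≡true : ∀ {m n} → m < n → (m <ᵇ n) ≡ true
<⇒<ᵇ≡true m<n = Equivalence.to T-≡ (ℕ.<⇒<ᵇ m<n)

≮⇒<ᵇ≡false : ∀ {m n} → ¬ m < n → (m <ᵇ n) ≡ false
≮⇒<ᵇ≡false {m} {n} m≮n with m <ᵇ n in eq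
... | false = refl
... | true  = ⊥-elim (m≮n (ℕ.<ᵇ⇒< m n (subst T (sym eq) _)))

<ᵇ≡false⇒≥ : ∀ {m n} → (m <ᵇ n) ≡ false → n ≤ m
<ᵇ≡false⇒≥ eq = ℕ.≮⇒≥ λ m<n → subst T eq (ℕ.<⇒<ᵇ m<n)

≢⇒≡ᵇ≡false : ∀ {m n} → m ≢ n → (m ≡ᵇ n) ≡ false
≢⇒≡ᵇ≡false {m} {n} m≢n with m ≡ᵇ n in eq
... | false = refl
... | true  = ⊥-elim (m≢n (ℕ.≡ᵇ⇒≡ m n (subst T (sym eq) _)))

≡ᵇ≡true⇒≡ : ∀ {m n} → (m ≡ᵇ n) ≡ true → m ≡ n
≡ᵇ≡true⇒≡ {m} {n} eq = ℕ.≡ᵇ⇒≡ m n (subst T (sym eq) _)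

+-<ᵇ-cancelˡ : ∀ c x y → (c + x <ᵇ c + y) ≡ (x <ᵇ y)
+-<ᵇ-cancelˡ zero    x y = refl
+-<ᵇ-cancelˡ (suc c) x y = +-<ᵇ-cancelˡ c x y

code<2^ : ∀ {m} (w : Word m) → code w < 2 ^ m
code<2^ []                = s≤s z≤n
code<2^ {suc m} (false ∷ w) = ℕ.<-≤-trans (code<2^ w) (ℕ.m≤m+n (2 ^ m) _)
code<2^ {suc m} (true  ∷ w) = ℕ.+-monoʳ-< (2 ^ m) (ℕ.<-≤-trans (code<2^ w) (ℕ.m≤m+n (2 ^ m) 0))

isInversion : ∀ {m} → (Word m → Word m) → Word m → Word m → Bool
isInversion π u v = (code u <ᵇ code v) ∧ (code (π v) <ᵇ code (π u))

inversionBit : ∀ {m} → (Word m → Word m) → Bool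
inversionBit {m} π = ⨁[ u ∈ allWords m ] (⨁[ v ∈ allWords m ] isInversion π u v)

permSign≡bitSign-inversionBit : ∀ {m} (π : Word m → Word m) → permSign π ≡ bitSign (inversionBit π)
permSign≡bitSign-inversionBit {m} π = trans (parity≡bitSign-odd (inversions π)) (cong bitSign
  (trans (odd-sum (allWords m) _) (xorSum-cong (allWords m) λ u →
    trans (odd-sum (allWords m) _) (xorSum-cong (allWords m) λ v → odd-if (isInversion π u v)))))

inversionBit-cong : ∀ {m} {π π′ : Word m → Word m} → (∀ w → π w ≡ π′ w) → inversionBit π ≡ inversionBit π′
inversionBit-cong {m} e = xorSum-cong (allWords m) λ u → xorSum-cong (allWords m) λ v →
  cong₂ (λ a b → (code u <ᵇ code v) ∧ (code a <ᵇ code b)) (e v) (e u)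

module Quadrants (q : Portrait) (m : ℕ) where
  π = act q (suc m)
  π₀ = act (q ↾₁ false) m
  π₁ = act (q ↾₁ true) m

  below : ∀ x (w : Word m) → code w < 2 ^ m + x
  below x w = ℕ.<-≤-trans (code<2^ w) (ℕ.m≤m+n (2 ^ m) x)

  not-above : ∀ x (w : Word m) → ¬ 2 ^ m + x < code w
  not-above x w lt = ℕ.<-asym lt (below x w)

  inv-00 : ∀ u v → isInversion π (false ∷ u) (false ∷ v) ≡ isInversion π₀ u v
  inv-00 u v = cong ((code u <ᵇ code v) ∧_) (+-<ᵇ-cancelˡ (if q 0 [] then 2 ^ m else 0) _ _)

  inv-11 : ∀ u v → isInversion π (true ∷ u) (true ∷ v) ≡ isInversion π₁ u v
  inv-11 u v = cong₂ _∧_ (+-<ᵇ-cancelˡ (2 ^ m) (code u) (code v))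
                         (+-<ᵇ-cancelˡ (if not (q 0 []) then 2 ^ m else 0) _ _)

  inv-10 : ∀ u v → isInversion π (true ∷ u) (false ∷ v) ≡ false
  inv-10 u v rewrite ≮⇒<ᵇ≡false (not-above (code u) v) = refl

  inv-01 : ∀ u v → isInversion π (false ∷ u) (true ∷ v) ≡ q 0 []
  inv-01 u v rewrite <⇒<ᵇ≡true (below (code v) u) with q 0 []
  ... | true  = <⇒<ᵇ≡true (below (code (π₀ u)) (π₁ v))
  ... | false = ≮⇒<ᵇ≡false (not-above (code (π₁ v)) (π₀ u))

inversionBit-act-suc : ∀ q m → inversionBit (act q (suc m)) ≡
  (inversionBit (act (q ↾₁ false) m) xor inversionBit (act (q ↾₁ true) m)) xor ((m ≡ᵇ 0) ∧ q 0 [])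
inversionBit-act-suc q m = begin
  inversionBit π
    ≡⟨ ⨁-allWords-suc m _ ⟩
  (⨁[ u ∈ allWords m ] row (false ∷ u)) xor (⨁[ u ∈ allWords m ] row (true ∷ u))
    ≡⟨ cong₂ _xor_ (xorSum-cong (allWords m) row₀) (xorSum-cong (allWords m) row₁) ⟩
  (⨁[ u ∈ allWords m ] (xorSum (allWords m) (isInversion π₀ u) xor c)) xor inversionBit π₁
    ≡⟨ cong (_xor inversionBit π₁) (xorSum-xor (allWords m) _ _) ⟩
  (inversionBit π₀ xor (⨁[ _ ∈ allWords m ] c)) xor inversionBit π₁
    ≡⟨ cong (λ x → (inversionBit π₀ xor x) xor inversionBit π₁) twice ⟩
  (inversionBit π₀ xor c) xor inversionBit π₁
    ≡⟨ xy∙z≈xz∙y (inversionBit π₀) c (inversionBit π₁) ⟩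
  (inversionBit π₀ xor inversionBit π₁) xor c ∎
  where
  open ≡-Reasoning
  open Quadrants q m
  c = (m ≡ᵇ 0) ∧ q 0 []
  row : Word (suc m) → Bool
  row u = xorSum (allWords (suc m)) (isInversion π u)
  row₀ : ∀ u → row (false ∷ u) ≡ xorSum (allWords m) (isInversion π₀ u) xor c
  row₀ u = trans (⨁-allWords-suc m _) (cong₂ _xor_ (xorSum-cong (allWords m) (inv-00 u))
    (trans (xorSum-cong (allWords m) (inv-01 u)) (⨁-allWords-const m (q 0 []))))
  row₁ : ∀ u → row (true ∷ u) ≡ xorSum (allWords m) (isInversion π₁ u)
  row₁ u = trans (⨁-allWords-suc m _) (cong₂ _xor_ (xorSum-zero (allWords m) _ (inv-10 u))
    (xorSum-cong (allWords m) (inv-11 u)))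
  twice : (⨁[ _ ∈ allWords m ] c) ≡ c
  twice = trans (⨁-allWords-const m c)
    (trans (sym (∧-assoc (m ≡ᵇ 0) (m ≡ᵇ 0) (q 0 []))) (cong (_∧ q 0 []) (∧-idem (m ≡ᵇ 0))))

-- Only the last of m levels contributes to the sign of act q m (inversionBit-act):
-- a flip higher up swaps two subtrees, an even number of transpositions.
bottomParity : ℕ → Portrait → Bool
bottomParity zero    q = false
bottomParity (suc m) q = xorSum (allWords m) (q m)

inversionBit-act : ∀ m q → inversionBit (act q m) ≡ bottomParity m q
inversionBit-act zero          q = refl
inversionBit-act (suc zero)    q = trans (inversionBit-act-suc q 0) (sym (xor-identityʳ (q 0 [])))
inversionBit-act (suc (suc m)) q = begin
  inversionBit (act q (suc (suc m)))
    ≡⟨ inversionBit-act-suc q (suc m) ⟩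
  (inversionBit (act (q ↾₁ false) (suc m)) xor inversionBit (act (q ↾₁ true) (suc m))) xor false
    ≡⟨ xor-identityʳ _ ⟩
  inversionBit (act (q ↾₁ false) (suc m)) xor inversionBit (act (q ↾₁ true) (suc m))
    ≡⟨ cong₂ _xor_ (inversionBit-act (suc m) (q ↾₁ false)) (inversionBit-act (suc m) (q ↾₁ true)) ⟩
  bottomParity (suc m) (q ↾₁ false) xor bottomParity (suc m) (q ↾₁ true)
    ≡⟨ ⨁-allWords-suc m (q (suc m)) ⟨
  bottomParity (suc (suc m)) q ∎
  where open ≡-Reasoning

bottomParity-cong : ∀ m {p q} → p ≗ᵖ q → bottomParity m p ≡ bottomParity m q
bottomParity-cong zero    e = refl
bottomParity-cong (suc m) e = xorSum-cong (allWords m) (e m)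

bottomParity-∙ᵖ : ∀ m q r → bottomParity m (q ∙ᵖ r) ≡ bottomParity m q xor bottomParity m r
bottomParity-∙ᵖ zero    q r = refl
bottomParity-∙ᵖ (suc m) q r = trans (xorSum-xor (allWords m) (r m) (λ u → q m (act r m u)))
  (trans (cong (xorSum (allWords m) (r m) xor_) (⨁-allWords-act m r (q m)))
    (xor-comm (xorSum (allWords m) (r m)) _))

sgnBit : ℕ → TreeAut → ∀ {k} → Word k → Bool
sgnBit m σ y = bottomParity m (portrait σ ↾ y)

drop-++ : ∀ {k m} (y : Word k) (s : Word m) → drop k (y ++ s) ≡ s
drop-++ []      s = refl
drop-++ (b ∷ y) s = drop-++ y s

sgn≡bitSign-sgnBit : ∀ m σ {k} (y : Word k) → sgn m σ y ≡ bitSign (sgnBit m σ y)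
sgn≡bitSign-sgnBit m σ {k} y = trans (permSign≡bitSign-inversionBit (localPerm σ m y))
  (cong bitSign (trans (inversionBit-cong localPerm≗act) (inversionBit-act m (portrait σ ↾ y))))
  where
  localPerm≗act : ∀ s → localPerm σ m y s ≡ act (portrait σ ↾ y) m s
  localPerm≗act s = trans (cong (drop k) (trans (f≗act-portrait σ (k + m) (y ++ s)) (act-++ (portrait σ) y s)))
                          (drop-++ (act (portrait σ) k y) _)

sgnBit-∘ᵀ : ∀ m σ τ {k} (y : Word k) → sgnBit m (σ ∘ᵀ τ) y ≡ sgnBit m σ (f τ k y) xor sgnBit m τ y
sgnBit-∘ᵀ m σ τ {k} y = trans (bottomParity-cong m (↾-cong (portrait-∘ᵀ σ τ) y))
  (trans (bottomParity-cong m (↾-∙ᵖ (portrait σ) (portrait τ) y))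
  (trans (bottomParity-∙ᵖ m _ _)
    (cong (λ z → bottomParity m (portrait σ ↾ z) xor sgnBit m τ y) (sym (f≗act-portrait τ k y)))))

sgnBit-ext : ∀ m σ τ → (∀ k w → f σ k w ≡ f τ k w) → ∀ {k} (y : Word k) → sgnBit m σ y ≡ sgnBit m τ y
sgnBit-ext m σ τ e y = bottomParity-cong m (↾-cong
  (portrait-unique σ (portrait τ) λ k w → trans (e k w) (f≗act-portrait τ k w)) y)

sgnBit-idAut : ∀ m {k} (y : Word k) → sgnBit m idAut y ≡ false
sgnBit-idAut zero    y = refl
sgnBit-idAut (suc m) y = xorSum-zero (allWords m) _ λ t →
  trans (↾-cong portrait-idAut y m t) (↾-++ (λ _ _ → false) y m t)

sgnBit-children : ∀ r σ {k} (v : Word k) →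
  sgnBit (suc (suc r)) σ v ≡ sgnBit (suc r) σ (v ∷ʳ false) xor sgnBit (suc r) σ (v ∷ʳ true)
sgnBit-children r σ v = trans (⨁-allWords-suc r _)
  (sym (cong₂ _xor_ (xorSum-cong (allWords r) (↾-∷ʳ (portrait σ) v false r))
                    (xorSum-cong (allWords r) (↾-∷ʳ (portrait σ) v true r))))

sgnBit-restrict : ∀ n σ τ → σ ≈[ n ] τ → ∀ m {k} (y : Word k) → k + m ≤ n → sgnBit m σ y ≡ sgnBit m τ y
sgnBit-restrict n σ τ σ≈τ zero    y _ = refl
sgnBit-restrict n σ τ σ≈τ (suc m) {k} y k+m<n = xorSum-cong (allWords m) λ t → begin
  (portrait σ ↾ y) m t              ≡⟨ ↾-++ (portrait σ) y m t ⟩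
  portrait σ (k + m) (y ++ t)       ≡⟨ cong last (σ≈τ _ (subst (_≤ n) (ℕ.+-suc k m) k+m<n) ((y ++ t) ∷ʳ false)) ⟩
  portrait τ (k + m) (y ++ t)       ≡⟨ ↾-++ (portrait τ) y m t ⟨
  (portrait τ ↾ y) m t              ∎
  where open ≡-Reasoning

InM⇒sgnBit≡false : ∀ ℓ σ → InM ℓ σ → ∀ k (y : Word k) → sgnBit ℓ σ y ≡ false
InM⇒sgnBit≡false ℓ σ σ∈M k y = bitSign≡⊕⇒false (trans (sym (sgn≡bitSign-sgnBit ℓ σ y)) (σ∈M k y))

sgnBit≡false⇒InM : ∀ ℓ σ → (∀ k (y : Word k) → sgnBit ℓ σ y ≡ false) → InM ℓ σ
sgnBit≡false⇒InM ℓ σ h k y = trans (sgn≡bitSign-sgnBit ℓ σ y) (cong bitSign (h k y))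

InM-idAut : ∀ ℓ → InM ℓ idAut
InM-idAut ℓ = sgnBit≡false⇒InM ℓ idAut λ _ → sgnBit-idAut ℓ

InM-∘ᵀ : ∀ ℓ σ τ → InM ℓ σ → InM ℓ τ → InM ℓ (σ ∘ᵀ τ)
InM-∘ᵀ ℓ σ τ σ∈M τ∈M = sgnBit≡false⇒InM ℓ (σ ∘ᵀ τ) λ k y → trans (sgnBit-∘ᵀ ℓ σ τ y)
  (cong₂ _xor_ (InM⇒sgnBit≡false ℓ σ σ∈M k (f τ k y)) (InM⇒sgnBit≡false ℓ τ τ∈M k y))

InM-⁻¹ᵀ : ∀ ℓ σ → InM ℓ σ → InM ℓ (σ ⁻¹ᵀ)
InM-⁻¹ᵀ ℓ σ σ∈M = sgnBit≡false⇒InM ℓ (σ ⁻¹ᵀ) λ k y →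
  subst (λ z → sgnBit ℓ (σ ⁻¹ᵀ) z ≡ false) (f∘g σ k y) (at-image k (g σ k y))
  where
  open ≡-Reasoning
  at-image : ∀ k (x : Word k) → sgnBit ℓ (σ ⁻¹ᵀ) (f σ k x) ≡ false
  at-image k x = begin
    sgnBit ℓ (σ ⁻¹ᵀ) (f σ k x)                    ≡⟨ xor-identityʳ _ ⟨
    sgnBit ℓ (σ ⁻¹ᵀ) (f σ k x) xor false          ≡⟨ cong (sgnBit ℓ (σ ⁻¹ᵀ) (f σ k x) xor_)
                                                       (InM⇒sgnBit≡false ℓ σ σ∈M k x) ⟨
    sgnBit ℓ (σ ⁻¹ᵀ) (f σ k x) xor sgnBit ℓ σ x   ≡⟨ sgnBit-∘ᵀ ℓ (σ ⁻¹ᵀ) σ x ⟨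
    sgnBit ℓ ((σ ⁻¹ᵀ) ∘ᵀ σ) x                     ≡⟨ sgnBit-ext ℓ ((σ ⁻¹ᵀ) ∘ᵀ σ) idAut (g∘f σ) x ⟩
    sgnBit ℓ idAut x                              ≡⟨ sgnBit-idAut ℓ x ⟩
    false                                         ∎

InM-sgnBit-∷ʳ : ∀ r σ → InM (suc (suc r)) σ → ∀ {k} (v : Word k) c →
  sgnBit (suc r) σ (v ∷ʳ c) ≡ sgnBit (suc r) σ (v ∷ʳ false)
InM-sgnBit-∷ʳ r σ σ∈M v false = refl
InM-sgnBit-∷ʳ r σ σ∈M v true  = sym (xor≡false⇒≡
  (trans (sym (sgnBit-children r σ v)) (InM⇒sgnBit≡false (suc (suc r)) σ σ∈M _ v)))

negBit : ℕ → TreeAut → ∀ {k} → Word k → Bool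
negBit ℓ σ w = sgnBit (ℓ ∸ 1) σ (w ∷ʳ false) ∧ sgnBit (ℓ ∸ 1) σ (w ∷ʳ true)

ψBit : ℕ → ℕ → TreeAut → Bool
ψBit ℓ i σ = if i <ᵇ ℓ then sgnBit i σ [] else (⨁[ w ∈ allWords (i ∸ ℓ) ] negBit ℓ σ w)

actsNeg≡negBit : ∀ ℓ σ {k} (w : Word k) → actsNeg ℓ σ w ≡ negBit ℓ σ w
actsNeg≡negBit ℓ σ w = cong₂ _∧_ (isMinus-sgn (w ∷ʳ false)) (isMinus-sgn (w ∷ʳ true))
  where
  isMinus-sgn : ∀ {k} (y : Word k) → isMinus (sgn (ℓ ∸ 1) σ y) ≡ sgnBit (ℓ ∸ 1) σ y
  isMinus-sgn y = trans (cong isMinus (sgn≡bitSign-sgnBit (ℓ ∸ 1) σ y)) (isMinus-bitSign _)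

cousinSign≡bitSign : ∀ ℓ i σ → cousinSign ℓ i σ x₀ ≡ bitSign (⨁[ w ∈ allWords (i ∸ ℓ) ] negBit ℓ σ w)
cousinSign≡bitSign ℓ i σ = trans (parity≡bitSign-odd (negCount ℓ i σ x₀)) (cong bitSign
  (trans (odd-sum (allWords (i ∸ ℓ)) (λ w → if actsNeg ℓ σ w then 1 else 0)) (xorSum-cong (allWords (i ∸ ℓ)) λ w →
    trans (odd-if (actsNeg ℓ σ w)) (actsNeg≡negBit ℓ σ w))))

ψ≡tabulate-ψBit : ∀ ℓ n σ → ψ ℓ n σ ≡ tabulate (λ j → bitSign (ψBit ℓ (suc (toℕ j)) σ))
ψ≡tabulate-ψBit ℓ n σ = Vec.tabulate-cong λ j → coordinate (suc (toℕ j))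
  where
  coordinate : ∀ i → (if i <ᵇ ℓ then sgn i σ x₀ else cousinSign ℓ i σ x₀) ≡ bitSign (ψBit ℓ i σ)
  coordinate i with i <ᵇ ℓ
  ... | true  = sgn≡bitSign-sgnBit i σ []
  ... | false = cousinSign≡bitSign ℓ i σ

InM-negBit : ∀ r σ → InM (suc (suc r)) σ → ∀ {k} (w : Word k) →
  negBit (suc (suc r)) σ w ≡ sgnBit (suc r) σ (w ∷ʳ false)
InM-negBit r σ σ∈M w = trans (cong (sgnBit (suc r) σ (w ∷ʳ false) ∧_) (InM-sgnBit-∷ʳ r σ σ∈M w true)) (∧-idem _)

ψBit-ext : ∀ ℓ i σ τ → (∀ k w → f σ k w ≡ f τ k w) → ψBit ℓ i σ ≡ ψBit ℓ i τ
ψBit-ext ℓ i σ τ e with i <ᵇ ℓ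
... | true  = sgnBit-ext i σ τ e []
... | false = xorSum-cong (allWords (i ∸ ℓ)) λ w →
  cong₂ _∧_ (sgnBit-ext (ℓ ∸ 1) σ τ e (w ∷ʳ false)) (sgnBit-ext (ℓ ∸ 1) σ τ e (w ∷ʳ true))

ψBit-idAut : ∀ ℓ i → ψBit ℓ i idAut ≡ false
ψBit-idAut ℓ i with i <ᵇ ℓ
... | true  = sgnBit-idAut i []
... | false = xorSum-zero (allWords (i ∸ ℓ)) _ λ w →
  cong (_∧ sgnBit (ℓ ∸ 1) idAut (w ∷ʳ true)) (sgnBit-idAut (ℓ ∸ 1) (w ∷ʳ false))

zipWith-tabulate : ∀ {n} {X Y Z : Set} (op : X → Y → Z) (g : Fin n → X) (h : Fin n → Y) →
  zipWith op (tabulate g) (tabulate h) ≡ tabulate (λ i → op (g i) (h i))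
zipWith-tabulate {zero}  op g h = refl
zipWith-tabulate {suc n} op g h = cong (op (g Fin.zero) (h Fin.zero) ∷_) (zipWith-tabulate op (g ∘ Fin.suc) (h ∘ Fin.suc))

tabulate-const : ∀ {X : Set} n (x : X) → tabulate {n = n} (λ _ → x) ≡ replicate n x
tabulate-const zero    x = refl
tabulate-const (suc n) x = cong (x ∷_) (tabulate-const n x)

module _ (r : ℕ) where
  private ℓ = suc (suc r)

  ψBit-∘ᵀ : ∀ i σ τ → InM ℓ σ → InM ℓ τ → ψBit ℓ i (σ ∘ᵀ τ) ≡ ψBit ℓ i σ xor ψBit ℓ i τ
  ψBit-∘ᵀ i σ τ σ∈M τ∈M with i <ᵇ ℓ
  ... | true  = trans (sgnBit-∘ᵀ i σ τ []) (cong (λ z → sgnBit i σ z xor sgnBit i τ []) (root (f τ 0 [])))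
    where
    root : (w : Word 0) → w ≡ []
    root [] = refl
  ... | false = begin
    (⨁[ w ∈ allWords j ] negBit ℓ (σ ∘ᵀ τ) w)
      ≡⟨ xorSum-cong (allWords j) (λ w → trans (InM-negBit r (σ ∘ᵀ τ) (InM-∘ᵀ ℓ σ τ σ∈M τ∈M) w)
                                              (sgnBit-∘ᵀ (suc r) σ τ (w ∷ʳ false))) ⟩
    (⨁[ w ∈ allWords j ] (sgnBit (suc r) σ (f τ (suc j) (w ∷ʳ false)) xor sgnBit (suc r) τ (w ∷ʳ false)))
      ≡⟨ xorSum-xor (allWords j) (λ w → sgnBit (suc r) σ (f τ (suc j) (w ∷ʳ false)))
                                 (λ w → sgnBit (suc r) τ (w ∷ʳ false)) ⟩
    (⨁[ w ∈ allWords j ] sgnBit (suc r) σ (f τ (suc j) (w ∷ʳ false))) xor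
      (⨁[ w ∈ allWords j ] sgnBit (suc r) τ (w ∷ʳ false))
      ≡⟨ cong₂ _xor_ (xorSum-cong (allWords j) σ-image) (xorSum-cong (allWords j) (sym ∘ InM-negBit r τ τ∈M)) ⟩
    (⨁[ w ∈ allWords j ] negBit ℓ σ (act (portrait τ) j w)) xor (⨁[ w ∈ allWords j ] negBit ℓ τ w)
      ≡⟨ cong (_xor (⨁[ w ∈ allWords j ] negBit ℓ τ w)) (⨁-allWords-act j (portrait τ) (negBit ℓ σ)) ⟩
    (⨁[ w ∈ allWords j ] negBit ℓ σ w) xor (⨁[ w ∈ allWords j ] negBit ℓ τ w) ∎
    where
    open ≡-Reasoning
    j = i ∸ ℓ
    σ-image : ∀ w → sgnBit (suc r) σ (f τ (suc j) (w ∷ʳ false)) ≡ negBit ℓ σ (act (portrait τ) j w)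
    σ-image w = begin
      sgnBit (suc r) σ (f τ (suc j) (w ∷ʳ false))       ≡⟨ cong (sgnBit (suc r) σ) (f-∷ʳ τ j w false) ⟩
      sgnBit (suc r) σ (f τ j w ∷ʳ portrait τ j w)       ≡⟨ InM-sgnBit-∷ʳ r σ σ∈M (f τ j w) _ ⟩
      sgnBit (suc r) σ (f τ j w ∷ʳ false)                ≡⟨ InM-negBit r σ σ∈M (f τ j w) ⟨
      negBit ℓ σ (f τ j w)                               ≡⟨ cong (negBit ℓ σ) (f≗act-portrait τ j w) ⟩
      negBit ℓ σ (act (portrait τ) j w)                  ∎

  ψBit-restrict : ∀ n σ τ → σ ≈[ n ] τ → ∀ i → i ≤ n → ψBit ℓ i σ ≡ ψBit ℓ i τ
  ψBit-restrict n σ τ σ≈τ i i≤n with i <ᵇ ℓ in eq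
  ... | true  = sgnBit-restrict n σ τ σ≈τ i [] i≤n
  ... | false = xorSum-cong (allWords (i ∸ ℓ)) λ w →
    cong₂ _∧_ (sgnBit-restrict n σ τ σ≈τ (suc r) (w ∷ʳ false) fits)
              (sgnBit-restrict n σ τ σ≈τ (suc r) (w ∷ʳ true) fits)
    where
    fits : suc (i ∸ ℓ) + suc r ≤ n
    fits = subst (_≤ n) (trans (sym (ℕ.m∸n+n≡m (<ᵇ≡false⇒≥ {i} {ℓ} eq))) (ℕ.+-suc (i ∸ ℓ) (suc r))) i≤n

  ψ-∘ᵀ : ∀ n σ τ → InM ℓ σ → InM ℓ τ → ψ ℓ n (σ ∘ᵀ τ) ≡ zipWith _*_ (ψ ℓ n σ) (ψ ℓ n τ)
  ψ-∘ᵀ n σ τ σ∈M τ∈M = begin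
    ψ ℓ n (σ ∘ᵀ τ)
      ≡⟨ ψ≡tabulate-ψBit ℓ n (σ ∘ᵀ τ) ⟩
    tabulate (λ j → bitSign (ψBit ℓ (suc (toℕ j)) (σ ∘ᵀ τ)))
      ≡⟨ Vec.tabulate-cong (λ j → trans (cong bitSign (ψBit-∘ᵀ (suc (toℕ j)) σ τ σ∈M τ∈M))
                                        (bitSign-xor (ψBit ℓ (suc (toℕ j)) σ) (ψBit ℓ (suc (toℕ j)) τ))) ⟩
    tabulate (λ j → bitSign (ψBit ℓ (suc (toℕ j)) σ) * bitSign (ψBit ℓ (suc (toℕ j)) τ))
      ≡⟨ zipWith-tabulate _*_ _ _ ⟨
    zipWith _*_ (tabulate (λ j → bitSign (ψBit ℓ (suc (toℕ j)) σ))) (tabulate (λ j → bitSign (ψBit ℓ (suc (toℕ j)) τ)))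
      ≡⟨ cong₂ (zipWith _*_) (ψ≡tabulate-ψBit ℓ n σ) (ψ≡tabulate-ψBit ℓ n τ) ⟨
    zipWith _*_ (ψ ℓ n σ) (ψ ℓ n τ) ∎
    where open ≡-Reasoning

  ψ-restrict : ∀ n σ τ → σ ≈[ n ] τ → ψ ℓ n σ ≡ ψ ℓ n τ
  ψ-restrict n σ τ σ≈τ = trans (ψ≡tabulate-ψBit ℓ n σ) (trans (Vec.tabulate-cong λ j →
    cong bitSign (ψBit-restrict n σ τ σ≈τ (suc (toℕ j)) (FinP.toℕ<n j))) (sym (ψ≡tabulate-ψBit ℓ n τ)))

  ψBit-⁻¹ᵀ : ∀ i σ → InM ℓ σ → ψBit ℓ i (σ ⁻¹ᵀ) ≡ ψBit ℓ i σ
  ψBit-⁻¹ᵀ i σ σ∈M = xor≡false⇒≡ (trans (sym (ψBit-∘ᵀ i (σ ⁻¹ᵀ) σ (InM-⁻¹ᵀ ℓ σ σ∈M) σ∈M))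
    (trans (ψBit-ext ℓ i ((σ ⁻¹ᵀ) ∘ᵀ σ) idAut (g∘f σ)) (ψBit-idAut ℓ i)))

  InM-commutator : ∀ a b → InM ℓ a → InM ℓ b → InM ℓ [ a , b ]ᵀ
  InM-commutator a b a∈M b∈M = InM-∘ᵀ ℓ (a ⁻¹ᵀ) ((b ⁻¹ᵀ) ∘ᵀ (a ∘ᵀ b)) (InM-⁻¹ᵀ ℓ a a∈M)
    (InM-∘ᵀ ℓ (b ⁻¹ᵀ) (a ∘ᵀ b) (InM-⁻¹ᵀ ℓ b b∈M) (InM-∘ᵀ ℓ a b a∈M b∈M))

  ψBit-commutator : ∀ i a b → InM ℓ a → InM ℓ b → ψBit ℓ i [ a , b ]ᵀ ≡ false
  ψBit-commutator i a b a∈M b∈M = begin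
    ψBit ℓ i [ a , b ]ᵀ
      ≡⟨ ψBit-∘ᵀ i (a ⁻¹ᵀ) ((b ⁻¹ᵀ) ∘ᵀ (a ∘ᵀ b)) (InM-⁻¹ᵀ ℓ a a∈M)
                 (InM-∘ᵀ ℓ (b ⁻¹ᵀ) (a ∘ᵀ b) (InM-⁻¹ᵀ ℓ b b∈M) ab∈M) ⟩
    ψBit ℓ i (a ⁻¹ᵀ) xor ψBit ℓ i ((b ⁻¹ᵀ) ∘ᵀ (a ∘ᵀ b))
      ≡⟨ cong (ψBit ℓ i (a ⁻¹ᵀ) xor_) (ψBit-∘ᵀ i (b ⁻¹ᵀ) (a ∘ᵀ b) (InM-⁻¹ᵀ ℓ b b∈M) ab∈M) ⟩
    ψBit ℓ i (a ⁻¹ᵀ) xor (ψBit ℓ i (b ⁻¹ᵀ) xor ψBit ℓ i (a ∘ᵀ b))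
      ≡⟨ cong₂ (λ x y → x xor (y xor ψBit ℓ i (a ∘ᵀ b))) (ψBit-⁻¹ᵀ i a a∈M) (ψBit-⁻¹ᵀ i b b∈M) ⟩
    A xor (B xor ψBit ℓ i (a ∘ᵀ b))
      ≡⟨ cong (λ z → A xor (B xor z)) (ψBit-∘ᵀ i a b a∈M b∈M) ⟩
    A xor (B xor (A xor B))
      ≡⟨ cong (A xor_) (xor-comm B (A xor B)) ⟩
    A xor ((A xor B) xor B)
      ≡⟨ cong (A xor_) (xor-cancelʳ A B) ⟩
    A xor A
      ≡⟨ xor-same A ⟩
    false ∎
    where
    open ≡-Reasoning
    ab∈M = InM-∘ᵀ ℓ a b a∈M b∈M
    A = ψBit ℓ i a
    B = ψBit ℓ i b

≈-trans : ∀ {n σ τ ρ} → σ ≈[ n ] τ → τ ≈[ n ] ρ → σ ≈[ n ] ρ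
≈-trans σ≈τ τ≈ρ m m≤n w = trans (σ≈τ m m≤n w) (τ≈ρ m m≤n w)

≈-∘ᵀ : ∀ {n a a′ b b′} → a ≈[ n ] a′ → b ≈[ n ] b′ → (a ∘ᵀ b) ≈[ n ] (a′ ∘ᵀ b′)
≈-∘ᵀ {a = a} {b′ = b′} a≈a′ b≈b′ m m≤n w = trans (cong (f a m) (b≈b′ m m≤n w)) (a≈a′ m m≤n (f b′ m w))

≈-⁻¹ᵀ : ∀ {n a a′} → a ≈[ n ] a′ → (a ⁻¹ᵀ) ≈[ n ] (a′ ⁻¹ᵀ)
≈-⁻¹ᵀ {a = a} {a′} a≈a′ m m≤n w =
  trans (sym (g∘f a′ m (g a m w))) (cong (g a′ m) (trans (sym (a≈a′ m m≤n (g a m w))) (f∘g a m w)))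

≗⇒≈ : ∀ {n} σ τ → (∀ k w → f σ k w ≡ f τ k w) → σ ≈[ n ] τ
≗⇒≈ σ τ e m _ w = e m w

-- The commutator subgroup lies in the kernel

module _ (r n : ℕ) where
  private ℓ = suc (suc r)

  -- Elements of InCommutator are only known up to ≈[ n ]: the kernel property is
  -- proved for a representative in M_ℓ and transported by ψ-restrict.
  InCommutator⇒ψBit-representative : ∀ σ → InCommutator ℓ n σ →
    ∃ λ τ → InM ℓ τ × (∀ i → ψBit ℓ i τ ≡ false) × σ ≈[ n ] τ
  InCommutator⇒ψBit-representative σ (gen a b .σ a∈M b∈M σ≈) =
    [ a , b ]ᵀ , InM-commutator r a b a∈M b∈M , (λ i → ψBit-commutator r i a b a∈M b∈M) , σ≈
  InCommutator⇒ψBit-representative σ (unit .σ σ≈) = idAut , InM-idAut ℓ , ψBit-idAut ℓ , σ≈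
  InCommutator⇒ψBit-representative σ (mul a b .σ a∈C b∈C σ≈)
    with InCommutator⇒ψBit-representative a a∈C | InCommutator⇒ψBit-representative b b∈C
  ... | τa , τa∈M , ψτa , a≈ | τb , τb∈M , ψτb , b≈ =
    τa ∘ᵀ τb , InM-∘ᵀ ℓ τa τb τa∈M τb∈M ,
    (λ i → trans (ψBit-∘ᵀ r i τa τb τa∈M τb∈M) (cong₂ _xor_ (ψτa i) (ψτb i))) ,
    ≈-trans {n} {σ} {a ∘ᵀ b} {τa ∘ᵀ τb} σ≈ (≈-∘ᵀ {n} {a} {τa} {b} {τb} a≈ b≈)
  InCommutator⇒ψBit-representative σ (inv a .σ a∈C σ≈)
    with InCommutator⇒ψBit-representative a a∈C
  ... | τa , τa∈M , ψτa , a≈ =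
    τa ⁻¹ᵀ , InM-⁻¹ᵀ ℓ τa τa∈M , (λ i → trans (ψBit-⁻¹ᵀ r i τa τa∈M) (ψτa i)) ,
    ≈-trans {n} {σ} {a ⁻¹ᵀ} {τa ⁻¹ᵀ} σ≈ (≈-⁻¹ᵀ {n} {a} {τa} a≈)

  InCommutator⇒ψ≡1 : ∀ σ → InCommutator ℓ n σ → ψ ℓ n σ ≡ replicate n ⊕
  InCommutator⇒ψ≡1 σ σ∈C with InCommutator⇒ψBit-representative σ σ∈C
  ... | τ , _ , ψτ , σ≈τ = trans (ψ-restrict r n σ τ σ≈τ) (trans (ψ≡tabulate-ψBit ℓ n τ)
    (trans (Vec.tabulate-cong (λ j → cong bitSign (ψτ (suc (toℕ j))))) (tabulate-const n ⊕)))

-- Portraits concentrated on one level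

slice : (L : ℕ) → (Word L → Bool) → Portrait
slice L x k v with k ℕ.≟ L
... | yes refl = x v
... | no _     = false

slice-at : ∀ L x v → slice L x L v ≡ x v
slice-at L x v rewrite ℕ.≟-diag {L} {L} refl = refl

slice-off : ∀ L x k v → k ≢ L → slice L x k v ≡ false
slice-off L x k v k≢L with k ℕ.≟ L
... | yes k≡L = ⊥-elim (k≢L k≡L)
... | no _    = refl

slice-cong : ∀ L {x y : Word L → Bool} → (∀ v → x v ≡ y v) → slice L x ≗ᵖ slice L y
slice-cong L e k v with k ℕ.≟ L
... | yes refl = e v
... | no _     = refl

VanishesBelow : ℕ → Portrait → Set
VanishesBelow L p = ∀ k → k < L → ∀ v → p k v ≡ false

VanishesFrom : ℕ → Portrait → Set
VanishesFrom L p = ∀ k → L ≤ k → ∀ v → p k v ≡ false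

slice-vanishesBelow : ∀ L x → VanishesBelow L (slice L x)
slice-vanishesBelow L x k k<L v = slice-off L x k v λ k≡L → ℕ.<-irrefl k≡L k<L

vanishesBelow-≤ : ∀ {L k p} → k ≤ L → VanishesBelow L p → VanishesBelow k p
vanishesBelow-≤ k≤L p₀ k′ k′<k = p₀ k′ (ℕ.<-≤-trans k′<k k≤L)

act-agree : ∀ p q k → (∀ k′ → k′ < k → ∀ v → p k′ v ≡ q k′ v) → ∀ w → act p k w ≡ act q k w
act-agree p q zero    e []      = refl
act-agree p q (suc k) e (b ∷ w) = cong₂ _∷_ (cong (b xor_) (e 0 (s≤s z≤n) []))
  (act-agree (p ↾₁ b) (q ↾₁ b) k (λ k′ k′<k v → e (suc k′) (s≤s k′<k) (b ∷ v)) w)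

act-vanishing : ∀ p k → VanishesBelow k p → ∀ w → act p k w ≡ w
act-vanishing p zero    p₀ []      = refl
act-vanishing p (suc k) p₀ (b ∷ w) = cong₂ _∷_ (trans (cong (b xor_) (p₀ 0 (s≤s z≤n) [])) (xor-identityʳ b))
  (act-vanishing (p ↾₁ b) k (λ k′ k′<k v → p₀ (suc k′) (s≤s k′<k) (b ∷ v)) w)

act⁻¹-vanishing : ∀ p k → VanishesBelow k p → ∀ w → act⁻¹ p k w ≡ w
act⁻¹-vanishing p k p₀ w = trans (cong (act⁻¹ p k) (sym (act-vanishing p k p₀ w))) (act⁻¹-act p k w)

slice-xor : ∀ L x y → slice L (λ v → x v xor y v) ≗ᵖ (slice L x ∙ᵖ slice L y)
slice-xor L x y k u with k ℕ.≟ L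
... | yes refl = trans (xor-comm (x u) (y u))
      (cong (y u xor_) (cong x (sym (act-vanishing (slice L y) L (slice-vanishesBelow L y) u))))
... | no _     = refl

truncate : ℕ → Portrait → Portrait
truncate L p k v = (k <ᵇ L) ∧ p k v

truncate-suc : ∀ L p → truncate (suc L) p ≗ᵖ (truncate L p ∙ᵖ slice L (p L))
truncate-suc L p k u with ℕ.<-cmp k L
... | tri< k<L k≢L _ = begin
  (k <ᵇ suc L) ∧ p k u                           ≡⟨ cong (_∧ p k u) (<⇒<ᵇ≡true (ℕ.m<n⇒m<1+n k<L)) ⟩
  p k u                                           ≡⟨ cong (_∧ p k u) (<⇒<ᵇ≡true k<L) ⟨
  (k <ᵇ L) ∧ p k u                                ≡⟨ cong (λ z → (k <ᵇ L) ∧ p k z) (act-vanishing (slice L (p L)) k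
                                                       (vanishesBelow-≤ (ℕ.<⇒≤ k<L) (slice-vanishesBelow L (p L))) u) ⟨
  (k <ᵇ L) ∧ p k (act (slice L (p L)) k u)        ≡⟨ cong (_xor truncate L p k (act (slice L (p L)) k u))
                                                       (slice-off L (p L) k u k≢L) ⟨
  slice L (p L) k u xor truncate L p k (act (slice L (p L)) k u) ∎
  where open ≡-Reasoning
... | tri≈ _ refl _ = sym (trans
  (cong₂ _xor_ (slice-at k (p k) u) (cong (_∧ p k (act (slice k (p k)) k u)) (≮⇒<ᵇ≡false {k} {k} (ℕ.<-irrefl refl))))
  (trans (xor-identityʳ (p k u)) (cong (_∧ p k u) (sym (<⇒<ᵇ≡true (ℕ.n<1+n k))))))
... | tri> _ k≢L L<k = sym (trans
  (cong₂ _xor_ (slice-off L (p L) k u k≢L) (cong (_∧ p k (act (slice L (p L)) k u)) (≮⇒<ᵇ≡false (ℕ.<-asym L<k))))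
  (cong (_∧ p k u) (sym (≮⇒<ᵇ≡false λ k<1+L → ℕ.<-irrefl refl (ℕ.<-≤-trans L<k (ℕ.≤-pred k<1+L))))))

≈-truncate : ∀ n σ → σ ≈[ n ] fromPortrait (truncate n (portrait σ))
≈-truncate n σ m m≤n w = trans (f≗act-portrait σ m w) (act-agree _ _ m
  (λ k k<m v → cong (_∧ portrait σ k v) (sym (<⇒<ᵇ≡true (ℕ.<-≤-trans k<m m≤n)))) w)

flipAt : ∀ {m} → Fin m → Word m → Word m
flipAt Fin.zero    (b ∷ w) = not b ∷ w
flipAt (Fin.suc i) (b ∷ w) = b ∷ flipAt i w

hypercube-connected : ∀ m (R : Word m → Word m → Set) → Reflexive R → Transitive R →
  (∀ t i → R t (flipAt i t)) → ∀ t t′ → R t t′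
hypercube-connected zero    R refl′ trans′ edge [] [] = refl′
hypercube-connected (suc m) R refl′ trans′ edge (b ∷ t) (c ∷ t′) =
  trans′ (hypercube-connected m (λ x y → R (b ∷ x) (b ∷ y)) refl′ trans′ (λ x i → edge (b ∷ x) (Fin.suc i)) t t′)
         (first b c)
  where
  first : ∀ b c → R (b ∷ t′) (c ∷ t′)
  first false false = refl′
  first false true  = edge _ Fin.zero
  first true  false = edge _ Fin.zero
  first true  true  = refl′

module Slices (ℓ n : ℕ) where

  InCommutatorSlice : ∀ L → (Word L → Bool) → Set
  InCommutatorSlice L x = InCommutator ℓ n (fromPortrait (slice L x))

  InCommutator-resp-≈ : ∀ {σ τ} → InCommutator ℓ n σ → τ ≈[ n ] σ → InCommutator ℓ n τ
  InCommutator-resp-≈ {σ} σ∈C τ≈σ = mul σ idAut _ σ∈C (unit idAut λ _ _ _ → refl) τ≈σ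

  InCommutatorSlice-cong : ∀ {L x y} → (∀ v → x v ≡ y v) → InCommutatorSlice L x → InCommutatorSlice L y
  InCommutatorSlice-cong {L} {x} {y} e x∈C =
    InCommutator-resp-≈ x∈C (≗⇒≈ (fromPortrait (slice L y)) (fromPortrait (slice L x))
                                (act-cong (slice-cong L (sym ∘ e))))

  InCommutatorSlice-zero : ∀ {L} → InCommutatorSlice L (λ _ → false)
  InCommutatorSlice-zero {L} = unit _ (≗⇒≈ (fromPortrait (slice L (λ _ → false))) idAut λ k →
    act-vanishing _ k λ k′ _ v → trivial k′ v)
    where
    trivial : ∀ k v → slice L (λ _ → false) k v ≡ false
    trivial k v with k ℕ.≟ L
    ... | yes refl = refl
    ... | no _     = refl

  InCommutatorSlice-xor : ∀ {L x y} → InCommutatorSlice L x → InCommutatorSlice L y →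
    InCommutatorSlice L (λ v → x v xor y v)
  InCommutatorSlice-xor {L} {x} {y} x∈C y∈C = mul _ _ _ x∈C y∈C (≗⇒≈ (fromPortrait (slice L (λ v → x v xor y v)))
    (fromPortrait (slice L x) ∘ᵀ fromPortrait (slice L y)) λ k w →
    trans (act-cong (slice-xor L x y) k w) (act-∙ᵖ (slice L x) (slice L y) k w))

  InCommutatorSlice-⨁ : ∀ {L} {A : Set} (xs : List A) (F : A → Word L → Bool) →
    (∀ a → InCommutatorSlice L (F a)) → InCommutatorSlice L (λ v → ⨁[ a ∈ xs ] F a v)
  InCommutatorSlice-⨁ []       F F∈C = InCommutatorSlice-zero
  InCommutatorSlice-⨁ (a ∷ xs) F F∈C = InCommutatorSlice-xor (F∈C a) (InCommutatorSlice-⨁ xs F F∈C)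

  InCommutatorSlice-span : ∀ {L m} (μ : Word m → Word L → Bool) →
    (∀ t i → InCommutatorSlice L (λ v → μ t v xor μ (flipAt i t) v)) →
    ∀ h → xorSum (allWords m) h ≡ false → InCommutatorSlice L (λ v → ⨁[ t ∈ allWords m ] (h t ∧ μ t v))
  InCommutatorSlice-span {L} {m} μ edge h Σh≡0 =
    InCommutatorSlice-cong combination (InCommutatorSlice-⨁ (allWords m) _ term)
    where
    t₀ = replicate m false
    Related : Word m → Word m → Set
    Related t t′ = InCommutatorSlice L (λ v → μ t v xor μ t′ v)
    related : ∀ t t′ → Related t t′
    related = hypercube-connected m Related
      (λ {t} → InCommutatorSlice-cong (λ v → sym (xor-same (μ t v))) InCommutatorSlice-zero)
      (λ {x} {y} {z} x~y y~z → InCommutatorSlice-cong (λ v → telescope (μ x v) (μ y v) (μ z v))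
                                  (InCommutatorSlice-xor x~y y~z))
      edge
      where
      telescope : ∀ a b c → (a xor b) xor (b xor c) ≡ a xor c
      telescope a b c = trans (xor-assoc a b (b xor c))
        (cong (a xor_) (trans (sym (xor-assoc b b c)) (cong (_xor c) (xor-same b))))
    term : ∀ t → InCommutatorSlice L (λ v → h t ∧ (μ t v xor μ t₀ v))
    term t with h t
    ... | true  = related t t₀
    ... | false = InCommutatorSlice-zero
    combination : ∀ v → (⨁[ t ∈ allWords m ] (h t ∧ (μ t v xor μ t₀ v))) ≡ (⨁[ t ∈ allWords m ] (h t ∧ μ t v))
    combination v = begin
      (⨁[ t ∈ allWords m ] (h t ∧ (μ t v xor μ t₀ v)))
        ≡⟨ xorSum-cong (allWords m) (λ t → ∧-distribˡ-xor (h t) (μ t v) (μ t₀ v)) ⟩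
      (⨁[ t ∈ allWords m ] ((h t ∧ μ t v) xor (h t ∧ μ t₀ v)))
        ≡⟨ xorSum-xor (allWords m) _ _ ⟩
      (⨁[ t ∈ allWords m ] (h t ∧ μ t v)) xor (⨁[ t ∈ allWords m ] (h t ∧ μ t₀ v))
        ≡⟨ cong ((⨁[ t ∈ allWords m ] (h t ∧ μ t v)) xor_)
             (trans (xorSum-∧ʳ (allWords m) h (μ t₀ v)) (cong (_∧ μ t₀ v) Σh≡0)) ⟩
      (⨁[ t ∈ allWords m ] (h t ∧ μ t v)) xor false
        ≡⟨ xor-identityʳ _ ⟩
      (⨁[ t ∈ allWords m ] (h t ∧ μ t v)) ∎
      where open ≡-Reasoning

  InCommutator-truncate : ∀ p L → (∀ L′ → L′ < L → InCommutatorSlice L′ (p L′)) →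
    InCommutator ℓ n (fromPortrait (truncate L p))
  InCommutator-truncate p zero    _     =
    unit _ (≗⇒≈ (fromPortrait (truncate 0 p)) idAut λ k → act-vanishing _ k λ _ _ _ → refl)
  InCommutator-truncate p (suc L) p∈C = mul _ _ _
    (InCommutator-truncate p L (λ L′ L′<L → p∈C L′ (ℕ.m<n⇒m<1+n L′<L))) (p∈C L (ℕ.n<1+n L))
    (≗⇒≈ (fromPortrait (truncate (suc L) p)) (fromPortrait (truncate L p) ∘ᵀ fromPortrait (slice L (p L)))
      λ k w → trans (act-cong (truncate-suc L p) k w) (act-∙ᵖ (truncate L p) (slice L (p L)) k w))

f-commutator : ∀ pa pb k w →
  f [ fromPortrait pa , fromPortrait pb ]ᵀ k w ≡ act ((pa ⁻¹ᵖ) ∙ᵖ ((pb ⁻¹ᵖ) ∙ᵖ (pa ∙ᵖ pb))) k w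
f-commutator pa pb k w = sym (trans (act-∙ᵖ (pa ⁻¹ᵖ) _ k w) (trans (act-⁻¹ᵖ pa k _)
  (cong (act⁻¹ pa k) (trans (act-∙ᵖ (pb ⁻¹ᵖ) _ k w) (trans (act-⁻¹ᵖ pb k _)
    (cong (act⁻¹ pb k) (act-∙ᵖ pa pb k w)))))))

-- If pa flips only on levels < L, its commutator with the slice of y at level L is the
-- slice of y + y ∘ act pa: on levels ≤ L the slice acts trivially and pa cancels against
-- its inverse, on the levels from L on pa flips nothing.
module CommutatorWithSlice (L : ℕ) (y : Word L → Bool) (pa : Portrait) (pa-high : VanishesFrom L pa) where
  pb = slice L y
  X = pa ∙ᵖ pb
  Y = (pb ⁻¹ᵖ) ∙ᵖ X
  Z = (pa ⁻¹ᵖ) ∙ᵖ Y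

  pb-low : ∀ k → k ≤ L → VanishesBelow k pb
  pb-low k k≤L = vanishesBelow-≤ k≤L (slice-vanishesBelow L y)

  act-X : ∀ k → k ≤ L → ∀ u → act X k u ≡ act pa k u
  act-X k k≤L u = trans (act-∙ᵖ pa pb k u) (cong (act pa k) (act-vanishing pb k (pb-low k k≤L) u))

  act-Y : ∀ k → k ≤ L → ∀ u → act Y k u ≡ act pa k u
  act-Y k k≤L u = trans (act-∙ᵖ (pb ⁻¹ᵖ) X k u)
    (trans (act-⁻¹ᵖ pb k _) (trans (act⁻¹-vanishing pb k (pb-low k k≤L) _) (act-X k k≤L u)))

  target : Portrait
  target = slice L (λ u → y u xor y (act pa L u))

  target-pair : ∀ k u → pb k u xor pb k (act pa k u) ≡ target k u
  target-pair k u with k ℕ.≟ L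
  ... | yes refl = refl
  ... | no _     = refl

  Z-low : ∀ k → k ≤ L → ∀ u → Z k u ≡ target k u
  Z-low k k≤L u = begin
    ((pb k u xor pa k (act pb k u)) xor pb k (act⁻¹ pb k (act X k u))) xor pa k (act⁻¹ pa k (act Y k u))
      ≡⟨ cong₂ (λ a c → ((pb k u xor pa k a) xor pb k (act⁻¹ pb k (act X k u))) xor pa k c)
           (act-vanishing pb k (pb-low k k≤L) u)
           (trans (cong (act⁻¹ pa k) (act-Y k k≤L u)) (act⁻¹-act pa k u)) ⟩
    ((pb k u xor pa k u) xor pb k (act⁻¹ pb k (act X k u))) xor pa k u
      ≡⟨ cong (λ b → ((pb k u xor pa k u) xor pb k b) xor pa k u)
           (trans (act⁻¹-vanishing pb k (pb-low k k≤L) _) (act-X k k≤L u)) ⟩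
    ((pb k u xor pa k u) xor pb k (act pa k u)) xor pa k u
      ≡⟨ xy∙z≈xz∙y (pb k u xor pa k u) (pb k (act pa k u)) (pa k u) ⟩
    ((pb k u xor pa k u) xor pa k u) xor pb k (act pa k u)
      ≡⟨ cong (_xor pb k (act pa k u)) (xor-cancelʳ (pb k u) (pa k u)) ⟩
    pb k u xor pb k (act pa k u)
      ≡⟨ target-pair k u ⟩
    target k u ∎
    where open ≡-Reasoning

  Z-high : ∀ k → L < k → ∀ u → Z k u ≡ target k u
  Z-high k L<k u = begin
    ((pb k u xor pa k (act pb k u)) xor pb k (act⁻¹ pb k (act X k u))) xor pa k (act⁻¹ pa k (act Y k u))
      ≡⟨ cong₂ (λ a c → ((pb k u xor a) xor pb k (act⁻¹ pb k (act X k u))) xor c) (pa-high k L≤k _) (pa-high k L≤k _) ⟩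
    ((pb k u xor false) xor pb k (act⁻¹ pb k (act X k u))) xor false
      ≡⟨ cong₂ (λ a b → ((a xor false) xor b) xor false) (off u) (off _) ⟩
    false
      ≡⟨ off u ⟨
    target k u ∎
    where
    open ≡-Reasoning
    L≤k = ℕ.<⇒≤ L<k
    off : ∀ {f} v → slice L f k v ≡ false
    off {f} v = slice-off L f k v λ k≡L → ℕ.<-irrefl (sym k≡L) L<k

  commutator-slice : Z ≗ᵖ target
  commutator-slice k u with k ℕ.≤? L
  ... | yes k≤L = Z-low k k≤L u
  ... | no k≰L  = Z-high k (ℕ.≰⇒> k≰L) u

module _ (ℓ n : ℕ) where
  open Slices ℓ n

  InCommutatorSlice-commutator : ∀ L y pa → InM ℓ (fromPortrait pa) → InM ℓ (fromPortrait (slice L y)) →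
    VanishesFrom L pa → InCommutatorSlice L (λ u → y u xor y (act pa L u))
  InCommutatorSlice-commutator L y pa a∈M b∈M pa-high = gen (fromPortrait pa) (fromPortrait (slice L y)) _ a∈M b∈M
    (≗⇒≈ (fromPortrait (slice L (λ u → y u xor y (act pa L u)))) [ fromPortrait pa , fromPortrait (slice L y) ]ᵀ λ k w →
      trans (act-cong (λ k u → sym (CommutatorWithSlice.commutator-slice L y pa pa-high k u)) k w)
            (sym (f-commutator pa (slice L y) k w)))

flipAt-involutive : ∀ {m} (i : Fin m) (w : Word m) → flipAt i (flipAt i w) ≡ w
flipAt-involutive Fin.zero    (b ∷ w) = cong (_∷ w) (not-involutive b)
flipAt-involutive (Fin.suc i) (b ∷ w) = cong (b ∷_) (flipAt-involutive i w)

flipAt-↑ʳ : ∀ {k m} (w : Word k) (s : Word m) i → flipAt (k ↑ʳ i) (w ++ s) ≡ w ++ flipAt i s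
flipAt-↑ʳ []      s i = refl
flipAt-↑ʳ (b ∷ w) s i = cong (b ∷_) (flipAt-↑ʳ w s i)

flipAt-↑ˡ : ∀ {k m} (w : Word k) (s : Word m) i → flipAt (i ↑ˡ m) (w ++ s) ≡ flipAt i w ++ s
flipAt-↑ˡ (b ∷ w) s Fin.zero    = refl
flipAt-↑ˡ (b ∷ w) s (Fin.suc i) = cong (b ∷_) (flipAt-↑ˡ w s i)

lookup-flipAt : ∀ {m} (p : Fin m) (x : Word m) → lookup (flipAt p x) p ≡ not (lookup x p)
lookup-flipAt Fin.zero    (b ∷ x) = refl
lookup-flipAt (Fin.suc p) (b ∷ x) = lookup-flipAt p x

lookup-flipAt-≢ : ∀ {m} (p q : Fin m) (x : Word m) → p ≢ q → lookup (flipAt q x) p ≡ lookup x p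
lookup-flipAt-≢ Fin.zero    Fin.zero    x       p≢q = ⊥-elim (p≢q refl)
lookup-flipAt-≢ Fin.zero    (Fin.suc q) (b ∷ x) p≢q = refl
lookup-flipAt-≢ (Fin.suc p) Fin.zero    (b ∷ x) p≢q = refl
lookup-flipAt-≢ (Fin.suc p) (Fin.suc q) (b ∷ x) p≢q = lookup-flipAt-≢ p q x (p≢q ∘ cong Fin.suc)

lookup-↑ˡ-++ : ∀ {k m} (w : Word k) (s s′ : Word m) x → lookup (w ++ s) (x ↑ˡ m) ≡ lookup (w ++ s′) (x ↑ˡ m)
lookup-↑ˡ-++ w s s′ x = trans (Vec.lookup-++ˡ w s x) (sym (Vec.lookup-++ˡ w s′ x))

isPrefix : ∀ {k L} → Word k → Word L → Bool
isPrefix []      u       = true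
isPrefix (b ∷ v) []      = false
isPrefix (b ∷ v) (c ∷ u) = does (b Bool.≟ c) ∧ isPrefix v u

agreeBefore : ∀ {L} → Fin L → Word L → Word L → Bool
agreeBefore Fin.zero    _       _       = true
agreeBefore (Fin.suc K) (b ∷ w) (c ∷ u) = does (b Bool.≟ c) ∧ agreeBefore K w u

agreeBefore-refl : ∀ {L} (K : Fin L) (a : Word L) → agreeBefore K a a ≡ true
agreeBefore-refl Fin.zero    a           = refl
agreeBefore-refl (Fin.suc K) (false ∷ a) = agreeBefore-refl K a
agreeBefore-refl (Fin.suc K) (true  ∷ a) = agreeBefore-refl K a

agreeBefore-flipAt : ∀ {L} (K p : Fin L) (x y : Word L) → toℕ K ≤ toℕ p →
  agreeBefore K (flipAt p x) y ≡ agreeBefore K x y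
agreeBefore-flipAt Fin.zero    p           x       y       _         = refl
agreeBefore-flipAt (Fin.suc K) (Fin.suc p) (b ∷ x) (c ∷ y) (s≤s K≤p) =
  cong (does (b Bool.≟ c) ∧_) (agreeBefore-flipAt K p x y K≤p)

agreeBefore-differ : ∀ {L} (K p : Fin L) (x y : Word L) → toℕ p < toℕ K →
  lookup x p ≢ lookup y p → agreeBefore K x y ≡ false
agreeBefore-differ (Fin.suc K) Fin.zero    (b ∷ x) (c ∷ y) _ b≢c = cong (_∧ agreeBefore K x y) (dec-false (b Bool.≟ c) b≢c)
agreeBefore-differ (Fin.suc K) (Fin.suc p) (b ∷ x) (c ∷ y) (s≤s p<K) x≢y =
  trans (cong (does (b Bool.≟ c) ∧_) (agreeBefore-differ K p x y p<K x≢y)) (∧-zeroʳ _)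

prefixFlip : ∀ {L} → Word L → Fin L → Portrait
prefixFlip a K k v = (k ≡ᵇ toℕ K) ∧ isPrefix v a

act-prefixFlip : ∀ {L} (a : Word L) K b →
  act (prefixFlip a K) L b ≡ (if agreeBefore K b a then flipAt K b else b)
act-prefixFlip (c ∷ a) Fin.zero    (d ∷ b) =
  cong₂ _∷_ (xor-comm d true) (act-vanishing _ _ (λ _ _ _ → refl) b)
act-prefixFlip (c ∷ a) (Fin.suc K) (d ∷ b) with d Bool.≟ c
... | yes refl = trans (cong₂ _∷_ (xor-identityʳ d) (act-prefixFlip a K b)) (if-float (d ∷_) (agreeBefore K b a))
... | no _     = cong₂ _∷_ (xor-identityʳ d) (act-vanishing _ _ (λ _ _ _ → ∧-zeroʳ _) b)

act-prefixFlip-involutive : ∀ {L} (a : Word L) K b → act (prefixFlip a K) L (act (prefixFlip a K) L b) ≡ b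
act-prefixFlip-involutive a K b rewrite act-prefixFlip a K b with agreeBefore K b a in agree
... | false = trans (act-prefixFlip a K b) (cong (λ c → if c then flipAt K b else b) agree)
... | true  = trans (act-prefixFlip a K (flipAt K b)) (trans
  (cong (λ c → if c then flipAt K (flipAt K b) else flipAt K b) (trans (agreeBefore-flipAt K K b a ℕ.≤-refl) agree))
  (flipAt-involutive K b))

act⁻¹-prefixFlip : ∀ {L} (a : Word L) K b →
  act⁻¹ (prefixFlip a K) L b ≡ (if agreeBefore K b a then flipAt K b else b)
act⁻¹-prefixFlip a K b = trans
  (cong (act⁻¹ (prefixFlip a K) _) (sym (act-prefixFlip-involutive a K b)))
  (trans (act⁻¹-act (prefixFlip a K) _ _) (act-prefixFlip a K b))

act⁻¹-prefixFlip-agree : ∀ {L} (a : Word L) K b → agreeBefore K b a ≡ true → act⁻¹ (prefixFlip a K) L b ≡ flipAt K b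
act⁻¹-prefixFlip-agree a K b agree = trans (act⁻¹-prefixFlip a K b) (cong (λ c → if c then flipAt K b else b) agree)

act⁻¹-prefixFlip-disagree : ∀ {L} (a : Word L) K b → agreeBefore K b a ≡ false → act⁻¹ (prefixFlip a K) L b ≡ b
act⁻¹-prefixFlip-disagree a K b disagree = trans (act⁻¹-prefixFlip a K b) (cong (λ c → if c then flipAt K b else b) disagree)

prefixFlip-vanishesBelow : ∀ {L} (a : Word L) K → VanishesBelow (toℕ K) (prefixFlip a K)
prefixFlip-vanishesBelow a K k k<K v =
  cong (_∧ isPrefix v a) (≢⇒≡ᵇ≡false λ k≡K → ℕ.<-irrefl k≡K k<K)

prefixFlip-vanishesFrom : ∀ {L} (a : Word L) K → VanishesFrom L (prefixFlip a K)
prefixFlip-vanishesFrom a K k L≤k v =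
  cong (_∧ isPrefix v a) (≢⇒≡ᵇ≡false λ k≡K → ℕ.<-irrefl (sym k≡K) (ℕ.<-≤-trans (FinP.toℕ<n K) L≤k))

vanishesFrom-∙ᵖ : ∀ {L q p} → VanishesFrom L q → VanishesFrom L p → VanishesFrom L (q ∙ᵖ p)
vanishesFrom-∙ᵖ q-high p-high k L≤k v = cong₂ _xor_ (p-high k L≤k v) (q-high k L≤k _)

⨁-isPrefix : ∀ {m L} (a : Word L) → m ≤ L → (⨁[ t ∈ allWords m ] isPrefix t a) ≡ true
⨁-isPrefix {zero}  a       _         = refl
⨁-isPrefix {suc m} (c ∷ a) (s≤s m≤L) = begin
  (⨁[ t ∈ allWords (suc m) ] isPrefix t (c ∷ a))
    ≡⟨ ⨁-allWords-suc m _ ⟩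
  (⨁[ t ∈ allWords m ] (does (false Bool.≟ c) ∧ isPrefix t a)) xor
    (⨁[ t ∈ allWords m ] (does (true Bool.≟ c) ∧ isPrefix t a))
    ≡⟨ cong₂ _xor_ (xorSum-∧ˡ (allWords m) (does (false Bool.≟ c)) (λ t → isPrefix t a))
                   (xorSum-∧ˡ (allWords m) (does (true Bool.≟ c)) (λ t → isPrefix t a)) ⟩
  (does (false Bool.≟ c) ∧ (⨁[ t ∈ allWords m ] isPrefix t a)) xor
    (does (true Bool.≟ c) ∧ (⨁[ t ∈ allWords m ] isPrefix t a))
    ≡⟨ cong (λ s → (does (false Bool.≟ c) ∧ s) xor (does (true Bool.≟ c) ∧ s)) (⨁-isPrefix a m≤L) ⟩
  (does (false Bool.≟ c) ∧ true) xor (does (true Bool.≟ c) ∧ true)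
    ≡⟨ exactly-one c ⟩
  true ∎
  where
  open ≡-Reasoning
  exactly-one : ∀ c → (does (false Bool.≟ c) ∧ true) xor (does (true Bool.≟ c) ∧ true) ≡ true
  exactly-one false = refl
  exactly-one true  = refl

⨁-isPrefix-++ : ∀ {k m L} (z : Word k) (a : Word L) → k + m ≤ L →
  (⨁[ t ∈ allWords m ] isPrefix (z ++ t) a) ≡ isPrefix z a
⨁-isPrefix-++         []      a       m≤L         = ⨁-isPrefix a m≤L
⨁-isPrefix-++ {m = m} (b ∷ z) (c ∷ a) (s≤s k+m≤L) =
  trans (xorSum-∧ˡ (allWords m) _ _) (cong (does (b Bool.≟ c) ∧_) (⨁-isPrefix-++ z a k+m≤L))

isPrefix-flipAt : ∀ {k L} (z : Word k) (a : Word L) p → k ≤ toℕ p → isPrefix z (flipAt p a) ≡ isPrefix z a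
isPrefix-flipAt []      a       p           _         = refl
isPrefix-flipAt (b ∷ z) (c ∷ a) (Fin.suc p) (s≤s k≤p) = cong (does (b Bool.≟ c) ∧_) (isPrefix-flipAt z a p k≤p)

-- sgn_ℓ at a node z at level k only sees the flips on level k + ℓ − 1 below z.
InM-fromPortrait : ∀ r q → (∀ k (z : Word k) → (⨁[ t ∈ allWords (suc r) ] q (k + suc r) (z ++ t)) ≡ false) →
  InM (suc (suc r)) (fromPortrait q)
InM-fromPortrait r q h = sgnBit≡false⇒InM (suc (suc r)) (fromPortrait q) λ k z →
  trans (xorSum-cong (allWords (suc r)) λ t →
    trans (↾-cong (portrait-fromPortrait q) z (suc r) t) (↾-++ q z (suc r) t)) (h k z)

⨁-prefixFlip : ∀ r {L} (a : Word L) K k (z : Word k) →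
  (⨁[ t ∈ allWords (suc r) ] prefixFlip a K (k + suc r) (z ++ t)) ≡ (k + suc r ≡ᵇ toℕ K) ∧ isPrefix z a
⨁-prefixFlip r {L} a K k z with k + suc r ≡ᵇ toℕ K in at-K
... | false = xorSum-zero (allWords (suc r)) _ λ _ → refl
... | true  = ⨁-isPrefix-++ z a (subst (_≤ L) (sym (≡ᵇ≡true⇒≡ at-K)) (ℕ.<⇒≤ (FinP.toℕ<n K)))

prefixFlip-InM : ∀ r {L} (a : Word L) K → toℕ K < suc r → InM (suc (suc r)) (fromPortrait (prefixFlip a K))
prefixFlip-InM r a K K<1+r = InM-fromPortrait r (prefixFlip a K) λ k z → trans (⨁-prefixFlip r a K k z)
  (cong (_∧ isPrefix z a) (≢⇒≡ᵇ≡false λ k+1+r≡K →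
    ℕ.<-irrefl (sym k+1+r≡K) (ℕ.<-≤-trans K<1+r (ℕ.m≤n+m (suc r) k))))

-- Two flips at level K whose nodes lie in one subtree of height ℓ − 1 have cancelling signs.
pairFlip : ∀ {L} → Word L → Fin L → Fin L → Portrait
pairFlip a K p = prefixFlip a K ∙ᵖ prefixFlip (flipAt p a) K

pairFlip-InM : ∀ r {L} (a : Word L) K p → (∀ k → k + suc r ≡ toℕ K → k ≤ toℕ p) →
  InM (suc (suc r)) (fromPortrait (pairFlip a K p))
pairFlip-InM r a K p same-subtree = InM-fromPortrait r (pairFlip a K p) λ k z → begin
  (⨁[ t ∈ allWords (suc r) ] pairFlip a K p (k + suc r) (z ++ t))
    ≡⟨ xorSum-cong (allWords (suc r)) (λ t → pair-sum (k + suc r) (z ++ t)) ⟩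
  (⨁[ t ∈ allWords (suc r) ] (prefixFlip a′ K (k + suc r) (z ++ t) xor prefixFlip a K (k + suc r) (z ++ t)))
    ≡⟨ xorSum-xor (allWords (suc r)) _ _ ⟩
  (⨁[ t ∈ allWords (suc r) ] prefixFlip a′ K (k + suc r) (z ++ t)) xor
    (⨁[ t ∈ allWords (suc r) ] prefixFlip a K (k + suc r) (z ++ t))
    ≡⟨ cong₂ _xor_ (⨁-prefixFlip r a′ K k z) (⨁-prefixFlip r a K k z) ⟩
  ((k + suc r ≡ᵇ toℕ K) ∧ isPrefix z a′) xor ((k + suc r ≡ᵇ toℕ K) ∧ isPrefix z a)
    ≡⟨ cancel k z ⟩
  false ∎
  where
  open ≡-Reasoning
  a′ = flipAt p a
  pair-sum : ∀ k v → pairFlip a K p k v ≡ prefixFlip a′ K k v xor prefixFlip a K k v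
  pair-sum k v with k ≡ᵇ toℕ K in at-K
  ... | false = refl
  ... | true  = cong (λ u → isPrefix v a′ xor (true ∧ isPrefix u a)) (act-vanishing (prefixFlip a′ K) k
      (subst (λ k → VanishesBelow k (prefixFlip a′ K)) (sym (≡ᵇ≡true⇒≡ at-K)) (prefixFlip-vanishesBelow a′ K)) v)
  cancel : ∀ k (z : Word k) →
    ((k + suc r ≡ᵇ toℕ K) ∧ isPrefix z a′) xor ((k + suc r ≡ᵇ toℕ K) ∧ isPrefix z a) ≡ false
  cancel k z with k + suc r ≡ᵇ toℕ K in at-K
  ... | false = refl
  ... | true  = trans (cong (_xor isPrefix z a) (isPrefix-flipAt z a p (same-subtree k (≡ᵇ≡true⇒≡ at-K))))
                      (xor-same (isPrefix z a))

slice-InM-low : ∀ r L y → L < suc r → InM (suc (suc r)) (fromPortrait (slice L y))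
slice-InM-low r L y L<1+r = InM-fromPortrait r (slice L y) λ k z → xorSum-zero (allWords (suc r)) _ λ t →
  slice-off L y (k + suc r) (z ++ t) λ e → ℕ.<-irrefl (sym e) (ℕ.<-≤-trans L<1+r (ℕ.m≤n+m (suc r) k))

slice-InM-high : ∀ r j y → (∀ (z : Word j) → (⨁[ t ∈ allWords (suc r) ] y (z ++ t)) ≡ false) →
  InM (suc (suc r)) (fromPortrait (slice (j + suc r) y))
slice-InM-high r j y balanced = InM-fromPortrait r (slice (j + suc r) y) level
  where
  level : ∀ k (z : Word k) → (⨁[ t ∈ allWords (suc r) ] slice (j + suc r) y (k + suc r) (z ++ t)) ≡ false
  level k z with k ℕ.≟ j
  ... | yes refl = trans (xorSum-cong (allWords (suc r)) λ t → slice-at (k + suc r) y (z ++ t)) (balanced z)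
  ... | no k≢j   = xorSum-zero (allWords (suc r)) _ λ t →
    slice-off (j + suc r) y (k + suc r) (z ++ t) (k≢j ∘ ℕ.+-cancelʳ-≡ (suc r) k j)

-- Generators of the level slices in the commutator subgroup

act⁻¹-∙ᵖ : ∀ q p k w → act⁻¹ (q ∙ᵖ p) k w ≡ act⁻¹ p k (act⁻¹ q k w)
act⁻¹-∙ᵖ q p k w = begin
  act⁻¹ (q ∙ᵖ p) k w                                           ≡⟨ cong (act⁻¹ (q ∙ᵖ p) k) (sym back) ⟩
  act⁻¹ (q ∙ᵖ p) k (act (q ∙ᵖ p) k (act⁻¹ p k (act⁻¹ q k w)))  ≡⟨ act⁻¹-act (q ∙ᵖ p) k _ ⟩
  act⁻¹ p k (act⁻¹ q k w)                                      ∎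
  where
  open ≡-Reasoning
  back : act (q ∙ᵖ p) k (act⁻¹ p k (act⁻¹ q k w)) ≡ w
  back = trans (act-∙ᵖ q p k _) (trans (cong (act q k) (act-act⁻¹ p k _)) (act-act⁻¹ q k w))

==-act : ∀ p L (u b : Word L) → (act p L u == b) ≡ (u == act⁻¹ p L b)
==-act p L u b = ==-⇔ (λ e → trans (sym (act⁻¹-act p L u)) (cong (act⁻¹ p L) e))
                      (λ e → trans (cong (act p L) e) (act-act⁻¹ p L b))

module Generators (r n : ℕ) where
  private ℓ = suc (suc r)
  open Slices ℓ n

  δ₂ : ∀ {L} → Word L → Word L → Word L → Bool
  δ₂ a b u = (u == a) xor (u == b)

  InCommutatorSlice-δ₂ : ∀ {L} (a b : Word L) π → InM ℓ (fromPortrait π) → VanishesFrom L π →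
    InM ℓ (fromPortrait (slice L (δ₂ a b))) →
    InCommutatorSlice L (λ u → δ₂ a b u xor δ₂ (act⁻¹ π L a) (act⁻¹ π L b) u)
  InCommutatorSlice-δ₂ {L} a b π π∈M π-high y∈M =
    InCommutatorSlice-cong (λ u → cong (δ₂ a b u xor_) (cong₂ _xor_ (==-act π L u a) (==-act π L u b)))
      (InCommutatorSlice-commutator ℓ n L (δ₂ a b) π π∈M y∈M π-high)

  -- At level L < ℓ − 1 a single δ-function is already in M_ℓ.
  edge-low : ∀ L → L < suc r → ∀ (a : Word L) K → InCommutatorSlice L (λ v → (v == a) xor (v == flipAt K a))
  edge-low L L<1+r a K = InCommutatorSlice-cong target
    (InCommutatorSlice-commutator ℓ n L (_== a) (prefixFlip a K)
      (prefixFlip-InM r a K (ℕ.<-trans (FinP.toℕ<n K) L<1+r)) (slice-InM-low r L _ L<1+r) (prefixFlip-vanishesFrom a K))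
    where
    target : ∀ u → (u == a) xor (act (prefixFlip a K) L u == a) ≡ (u == a) xor (u == flipAt K a)
    target u = cong ((u == a) xor_) (trans (==-act (prefixFlip a K) L u a)
      (cong (u ==_) (act⁻¹-prefixFlip-agree a K a (agreeBefore-refl K a))))

  record Flipper {L} (a : Word L) (K p : Fin L) : Set where
    field
      π      : Portrait
      π∈M    : InM ℓ (fromPortrait π)
      π-high : VanishesFrom L π
      act⁻¹-π : ∀ b → lookup b p ≡ lookup a p → act⁻¹ π L b ≡ act⁻¹ (prefixFlip a K) L b

  single-flipper : ∀ {L} (a : Word L) K p → toℕ K < suc r → Flipper a K p
  single-flipper a K p K<1+r = record
    { π = prefixFlip a K ; π∈M = prefixFlip-InM r a K K<1+r ; π-high = prefixFlip-vanishesFrom a K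
    ; act⁻¹-π = λ _ _ → refl }

  pair-flipper : ∀ {L} (a : Word L) K p → toℕ p < toℕ K → (∀ k → k + suc r ≡ toℕ K → k ≤ toℕ p) → Flipper a K p
  pair-flipper {L} a K p p<K same-subtree = record
    { π = pairFlip a K p ; π∈M = pairFlip-InM r a K p same-subtree
    ; π-high = vanishesFrom-∙ᵖ (prefixFlip-vanishesFrom a K) (prefixFlip-vanishesFrom a′ K)
    ; act⁻¹-π = λ b b≈a → trans (act⁻¹-∙ᵖ (prefixFlip a K) (prefixFlip a′ K) L b)
        (trans (act⁻¹-prefixFlip a′ K _) (cong (λ c → if c then _ else _) (agreeBefore-a′ b b≈a))) }
    where
    a′ = flipAt p a
    agreeBefore-a′ : ∀ b → lookup b p ≡ lookup a p → agreeBefore K (act⁻¹ (prefixFlip a K) L b) a′ ≡ false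
    agreeBefore-a′ b b≈a rewrite act⁻¹-prefixFlip a K b = trans (either (agreeBefore K b a))
      (agreeBefore-differ K p b a′ p<K λ b≈a′ → not-¬ refl (trans (sym b≈a) (trans b≈a′ (lookup-flipAt p a))))
      where
      either : ∀ c → agreeBefore K (if c then flipAt K b else b) a′ ≡ agreeBefore K b a′
      either true  = agreeBefore-flipAt K K b a′ ℕ.≤-refl
      either false = refl

  InCommutatorSlice-flipper : ∀ {L} (a b : Word L) {K p} → Flipper a K p → lookup b p ≡ lookup a p →
    InM ℓ (fromPortrait (slice L (δ₂ a b))) →
    InCommutatorSlice L (λ u → δ₂ a b u xor δ₂ (act⁻¹ (prefixFlip a K) L a) (act⁻¹ (prefixFlip a K) L b) u)
  InCommutatorSlice-flipper a b F b≈a y∈M = InCommutatorSlice-cong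
    (λ u → cong (δ₂ a b u xor_) (cong₂ (λ x y → δ₂ x y u) (act⁻¹-π a refl) (act⁻¹-π b b≈a)))
    (InCommutatorSlice-δ₂ a b π π∈M π-high y∈M)
    where open Flipper F

  δ₂-balanced : ∀ {j} (w : Word j) (s₁ s₂ : Word (suc r)) (z : Word j) →
    (⨁[ s ∈ allWords (suc r) ] δ₂ (w ++ s₁) (w ++ s₂) (z ++ s)) ≡ false
  δ₂-balanced w s₁ s₂ z = trans (xorSum-xor (allWords (suc r)) _ _)
    (trans (cong₂ _xor_ (⨁-==-++ (suc r) z w s₁) (⨁-==-++ (suc r) z w s₂)) (xor-same (z == w)))

  δ₂-InM : ∀ {j} (w : Word j) (s₁ s₂ : Word (suc r)) → InM ℓ (fromPortrait (slice (j + suc r) (δ₂ (w ++ s₁) (w ++ s₂))))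
  δ₂-InM {j} w s₁ s₂ = slice-InM-high r j _ (δ₂-balanced w s₁ s₂)

  -- Levels L = j + suc r ≥ ℓ − 1: a word is w ++ c ∷ t with w the first j letters.
  edge-high-t-via : ∀ {j} (w : Word j) c (t : Word r) (i : Fin r) {p} → Flipper (w ++ c ∷ t) (j ↑ʳ Fin.suc i) p →
    lookup (w ++ not c ∷ t) p ≡ lookup (w ++ c ∷ t) p →
    InCommutatorSlice (j + suc r) (λ v → (v == w ++ c ∷ t) xor (v == w ++ c ∷ flipAt i t))
  edge-high-t-via {j} w c t i F same-letter =
    InCommutatorSlice-cong target (InCommutatorSlice-flipper a b F same-letter (δ₂-InM w (c ∷ t) (not c ∷ t)))
    where
    L = j + suc r
    a = w ++ c ∷ t
    b = w ++ not c ∷ t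
    K = j ↑ʳ Fin.suc i
    b-disagrees : agreeBefore K b a ≡ false
    b-disagrees = agreeBefore-differ K (j ↑ʳ Fin.zero) b a
      (subst₂ _<_ (sym (FinP.toℕ-↑ʳ j Fin.zero)) (sym (FinP.toℕ-↑ʳ j (Fin.suc i))) (ℕ.+-monoʳ-< j (s≤s z≤n)))
      λ e → not-¬ refl (trans (sym (Vec.lookup-++ʳ w (c ∷ t) Fin.zero)) (trans (sym e) (Vec.lookup-++ʳ w (not c ∷ t) Fin.zero)))
    target : ∀ u → δ₂ a b u xor δ₂ (act⁻¹ (prefixFlip a K) L a) (act⁻¹ (prefixFlip a K) L b) u ≡
                   (u == a) xor (u == w ++ c ∷ flipAt i t)
    target u = begin
      δ₂ a b u xor δ₂ (act⁻¹ (prefixFlip a K) L a) (act⁻¹ (prefixFlip a K) L b) u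
        ≡⟨ cong₂ (λ x y → δ₂ a b u xor δ₂ x y u) (act⁻¹-prefixFlip-agree a K a (agreeBefore-refl K a))
                                                  (act⁻¹-prefixFlip-disagree a K b b-disagrees) ⟩
      ((u == a) xor (u == b)) xor ((u == flipAt K a) xor (u == b))
        ≡⟨ xor-cancel-middle (u == a) (u == b) (u == flipAt K a) ⟩
      (u == a) xor (u == flipAt K a)
        ≡⟨ cong (λ z → (u == a) xor (u == z)) (flipAt-↑ʳ w (c ∷ t) (Fin.suc i)) ⟩
      (u == a) xor (u == w ++ c ∷ flipAt i t) ∎
      where open ≡-Reasoning

  edge-high-t : ∀ j (w : Word j) c (t : Word r) (i : Fin r) →
    InCommutatorSlice (j + suc r) (λ v → (v == w ++ c ∷ t) xor (v == w ++ c ∷ flipAt i t))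
  edge-high-t zero     [] c t i = edge-high-t-via [] c t i (single-flipper _ _ (Fin.suc i) (s≤s (FinP.toℕ<n i))) refl
  edge-high-t (suc j′) w  c t i = edge-high-t-via w c t i
    (pair-flipper _ _ p (subst₂ _<_ (sym toℕ-p) (sym toℕ-K) (s≤s (ℕ.m≤m+n j′ (suc (toℕ i))))) same-subtree)
    (lookup-↑ˡ-++ w _ _ (Fin.fromℕ j′))
    where
    p = Fin.fromℕ j′ ↑ˡ suc r
    toℕ-p : toℕ p ≡ j′
    toℕ-p = trans (FinP.toℕ-↑ˡ (Fin.fromℕ j′) (suc r)) (FinP.toℕ-fromℕ j′)
    toℕ-K : toℕ (suc j′ ↑ʳ Fin.suc i) ≡ suc j′ + suc (toℕ i)
    toℕ-K = FinP.toℕ-↑ʳ (suc j′) (Fin.suc i)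
    same-subtree : ∀ k → k + suc r ≡ toℕ (suc j′ ↑ʳ Fin.suc i) → k ≤ toℕ p
    same-subtree k e = subst (k ≤_) (sym toℕ-p) (ℕ.+-cancelʳ-≤ (suc r) k j′ (begin
      k + suc r               ≡⟨ trans e toℕ-K ⟩
      suc j′ + suc (toℕ i)     ≡⟨ ℕ.+-suc j′ (suc (toℕ i)) ⟨
      j′ + suc (suc (toℕ i))   ≤⟨ ℕ.+-monoʳ-≤ j′ (s≤s (FinP.toℕ<n i)) ⟩
      j′ + suc r              ∎))
      where open ℕ.≤-Reasoning

  cousinPair : ∀ {j} → Word j → Word (j + suc r) → Bool
  cousinPair w = δ₂ (w ++ false ∷ replicate r false) (w ++ true ∷ replicate r false)

  edge-high-w-via : ∀ {j} (w : Word j) (i : Fin j) {p} →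
    Flipper (w ++ false ∷ replicate r false) (i ↑ˡ suc r) p →
    lookup (w ++ true ∷ replicate r false) p ≡ lookup (w ++ false ∷ replicate r false) p →
    InCommutatorSlice (j + suc r) (λ v → cousinPair w v xor cousinPair (flipAt i w) v)
  edge-high-w-via {j} w i F same-letter =
    InCommutatorSlice-cong target (InCommutatorSlice-flipper a b F same-letter (δ₂-InM w _ _))
    where
    L = j + suc r
    a = w ++ false ∷ replicate r false
    b = w ++ true ∷ replicate r false
    K = i ↑ˡ suc r
    b-agrees : agreeBefore K b a ≡ true
    b-agrees = trans (cong (λ z → agreeBefore K z a) (sym (flipAt-↑ʳ w (false ∷ replicate r false) Fin.zero)))
      (trans (agreeBefore-flipAt K (j ↑ʳ Fin.zero) a a K≤j) (agreeBefore-refl K a))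
      where
      K≤j : toℕ K ≤ toℕ (j ↑ʳ Fin.zero {r})
      K≤j = subst₂ _≤_ (sym (FinP.toℕ-↑ˡ i (suc r))) (sym (FinP.toℕ-↑ʳ j Fin.zero))
        (ℕ.≤-trans (ℕ.<⇒≤ (FinP.toℕ<n i)) (ℕ.m≤m+n j 0))
    target : ∀ u → δ₂ a b u xor δ₂ (act⁻¹ (prefixFlip a K) L a) (act⁻¹ (prefixFlip a K) L b) u ≡
                   cousinPair w u xor cousinPair (flipAt i w) u
    target u = cong (δ₂ a b u xor_) (cong₂ (λ x y → δ₂ x y u)
      (trans (act⁻¹-prefixFlip-agree a K a (agreeBefore-refl K a)) (flipAt-↑ˡ w _ i))
      (trans (act⁻¹-prefixFlip-agree a K b b-agrees) (flipAt-↑ˡ w _ i)))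

  edge-high-w : ∀ j (w : Word j) (i : Fin j) →
    InCommutatorSlice (j + suc r) (λ v → cousinPair w v xor cousinPair (flipAt i w) v)
  edge-high-w j w Fin.zero =
    edge-high-w-via w Fin.zero (single-flipper _ _ (Fin.zero ↑ˡ suc r) (s≤s z≤n)) (lookup-↑ˡ-++ w _ _ Fin.zero)
  edge-high-w (suc j₀) w (Fin.suc i′) = edge-high-w-via w (Fin.suc i′)
    (pair-flipper _ _ p
      (subst (_< suc (toℕ (i′ ↑ˡ suc r))) (sym toℕ-p) (s≤s (ℕ.≤-reflexive (sym (FinP.toℕ-↑ˡ i′ (suc r))))))
      same-subtree)
    (lookup-↑ˡ-++ w _ _ (Fin.inject₁ i′))
    where
    p = Fin.inject₁ i′ ↑ˡ suc r
    toℕ-p : toℕ p ≡ toℕ i′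
    toℕ-p = trans (FinP.toℕ-↑ˡ (Fin.inject₁ i′) (suc r)) (FinP.toℕ-inject₁ i′)
    same-subtree : ∀ k → k + suc r ≡ toℕ (Fin.suc i′ ↑ˡ suc r) → k ≤ toℕ p
    same-subtree k e = subst (k ≤_) (sym toℕ-p) (subst (k ≤_)
      (ℕ.suc-injective (trans (sym (ℕ.+-suc k r)) (trans e (cong suc (FinP.toℕ-↑ˡ i′ (suc r))))))
      (ℕ.m≤m+n k r))

  InCommutatorSlice-low : ∀ L (x : Word L → Bool) → L < suc r → xorSum (allWords L) x ≡ false →
    InCommutatorSlice L x
  InCommutatorSlice-low L x L<1+r Σx≡0 = InCommutatorSlice-cong (⨁-allWords-δ L x)
    (InCommutatorSlice-span (λ t v → v == t) (edge-low L L<1+r) x Σx≡0)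

  -- At level j + suc r, x is split into a part whose sums over each block
  -- {w ++ b ∷ t | t} vanish, spanned by edge-high-t, and a combination of
  -- cousin pairs with vanishing total, spanned by edge-high-w.
  module HighLevel (j : ℕ) (x : Word (j + suc r) → Bool)
      (balanced : ∀ (z : Word j) → (⨁[ s ∈ allWords (suc r) ] x (z ++ s)) ≡ false)
      (cousins : (⨁[ w ∈ allWords j ] (⨁[ t ∈ allWords r ] x (w ++ false ∷ t))) ≡ false) where
    L = j + suc r
    0ʳ = replicate r false

    blockSum : Word j → Bool → Bool
    blockSum w b = ⨁[ t ∈ allWords r ] x (w ++ b ∷ t)

    blockSum-true : ∀ w → blockSum w true ≡ blockSum w false
    blockSum-true w = sym (xor≡false⇒≡ (trans (sym (⨁-allWords-suc r (x ∘ (w ++_)))) (balanced w)))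

    h : Word j → Bool → Word r → Bool
    h w b t = x (w ++ b ∷ t) xor ((t == 0ʳ) ∧ blockSum w b)

    h-sum : ∀ w b → xorSum (allWords r) (h w b) ≡ false
    h-sum w b = trans (xorSum-xor (allWords r) _ _)
      (trans (cong (blockSum w b xor_) (trans (xorSum-∧ʳ (allWords r) (_== 0ʳ) (blockSum w b))
                                              (cong (_∧ blockSum w b) (⨁-allWords-== r 0ʳ))))
             (xor-same (blockSum w b)))

    part : Word j → Bool → Word L → Bool
    part w b v = ⨁[ t ∈ allWords r ] (h w b t ∧ (v == w ++ b ∷ t))

    part∈C : ∀ w b → InCommutatorSlice L (part w b)
    part∈C w b = InCommutatorSlice-span (λ t v → v == w ++ b ∷ t) (edge-high-t j w b) (h w b) (h-sum w b)

    cousinPart : Word L → Bool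
    cousinPart v = ⨁[ w ∈ allWords j ] (blockSum w false ∧ cousinPair w v)

    cousinPart∈C : InCommutatorSlice L cousinPart
    cousinPart∈C = InCommutatorSlice-span cousinPair (edge-high-w j) (λ w → blockSum w false) cousins

    restricted : Word j → Bool → Word L → Bool
    restricted w b v = ⨁[ t ∈ allWords r ] (x (w ++ b ∷ t) ∧ (v == w ++ b ∷ t))

    part≡ : ∀ w b v → part w b v ≡ restricted w b v xor (blockSum w b ∧ (v == w ++ b ∷ 0ʳ))
    part≡ w b v = begin
      part w b v
        ≡⟨ xorSum-cong (allWords r) (λ t → ∧-distribʳ-xor (v == w ++ b ∷ t) (x (w ++ b ∷ t)) _) ⟩
      (⨁[ t ∈ allWords r ] ((x (w ++ b ∷ t) ∧ (v == w ++ b ∷ t)) xor (((t == 0ʳ) ∧ blockSum w b) ∧ (v == w ++ b ∷ t))))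
        ≡⟨ xorSum-xor (allWords r) _ _ ⟩
      restricted w b v xor (⨁[ t ∈ allWords r ] (((t == 0ʳ) ∧ blockSum w b) ∧ (v == w ++ b ∷ t)))
        ≡⟨ cong (restricted w b v xor_) (trans (xorSum-cong (allWords r) reorder)
             (⨁-allWords-δ r (λ t → blockSum w b ∧ (v == w ++ b ∷ t)) 0ʳ)) ⟩
      restricted w b v xor (blockSum w b ∧ (v == w ++ b ∷ 0ʳ)) ∎
      where
      open ≡-Reasoning
      reorder : ∀ t → ((t == 0ʳ) ∧ blockSum w b) ∧ (v == w ++ b ∷ t) ≡ (blockSum w b ∧ (v == w ++ b ∷ t)) ∧ (0ʳ == t)
      reorder t = trans (cong (λ e → (e ∧ blockSum w b) ∧ (v == w ++ b ∷ t)) (==-sym t 0ʳ))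
        (trans (∧-assoc (0ʳ == t) _ _) (∧-comm (0ʳ == t) _))

    restricted-sum : ∀ v → (⨁[ w ∈ allWords j ] (restricted w false v xor restricted w true v)) ≡ x v
    restricted-sum v = trans (xorSum-cong (allWords j) (λ w → sym (⨁-allWords-suc r (λ s → x (w ++ s) ∧ (v == w ++ s)))))
      (trans (sym (⨁-allWords-+ j (suc r) (λ u → x u ∧ (v == u)))) (⨁-allWords-δ L x v))

    cousin-terms : ∀ w v → (blockSum w false ∧ (v == w ++ false ∷ 0ʳ)) xor (blockSum w true ∧ (v == w ++ true ∷ 0ʳ))
                           ≡ blockSum w false ∧ cousinPair w v
    cousin-terms w v = trans (cong (λ c → (blockSum w false ∧ (v == w ++ false ∷ 0ʳ)) xor (c ∧ (v == w ++ true ∷ 0ʳ)))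
                               (blockSum-true w))
                             (sym (∧-distribˡ-xor (blockSum w false) _ _))

    decomposition : ∀ v → (⨁[ w ∈ allWords j ] (part w false v xor part w true v)) xor cousinPart v ≡ x v
    decomposition v = begin
      (⨁[ w ∈ allWords j ] (part w false v xor part w true v)) xor cousinPart v
        ≡⟨ cong (_xor cousinPart v) (xorSum-cong (allWords j) λ w →
             trans (cong₂ _xor_ (part≡ w false v) (part≡ w true v))
                   (interchange (restricted w false v) (blockSum w false ∧ (v == w ++ false ∷ 0ʳ))
                                (restricted w true v) (blockSum w true ∧ (v == w ++ true ∷ 0ʳ)))) ⟩
      (⨁[ w ∈ allWords j ] ((restricted w false v xor restricted w true v) xor
          ((blockSum w false ∧ (v == w ++ false ∷ 0ʳ)) xor (blockSum w true ∧ (v == w ++ true ∷ 0ʳ))))) xor cousinPart v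
        ≡⟨ cong (_xor cousinPart v) (trans (xorSum-xor (allWords j) _ _)
             (cong₂ _xor_ (restricted-sum v) (xorSum-cong (allWords j) λ w → cousin-terms w v))) ⟩
      (x v xor cousinPart v) xor cousinPart v
        ≡⟨ xor-cancelʳ (x v) (cousinPart v) ⟩
      x v ∎
      where open ≡-Reasoning

    x∈C : InCommutatorSlice L x
    x∈C = InCommutatorSlice-cong decomposition (InCommutatorSlice-xor
      (InCommutatorSlice-⨁ (allWords j) _ (λ w → InCommutatorSlice-xor (part∈C w false) (part∈C w true)))
      cousinPart∈C)

  InCommutatorSlice-level : ∀ σ L → InM ℓ σ → ψBit ℓ (suc L) σ ≡ false → InCommutatorSlice L (portrait σ L)
  InCommutatorSlice-level σ L σ∈M ψBit≡0 with L <ᵇ suc r in below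
  ... | true  = InCommutatorSlice-low L (portrait σ L) (ℕ.<ᵇ⇒< L (suc r) (subst T (sym below) _)) ψBit≡0
  ... | false = subst (λ L → InCommutatorSlice L (portrait σ L)) (ℕ.m∸n+n≡m (<ᵇ≡false⇒≥ {L} {suc r} below))
      (HighLevel.x∈C j (portrait σ (j + suc r)) balanced cousins)
    where
    j = L ∸ suc r
    balanced : ∀ (z : Word j) → (⨁[ s ∈ allWords (suc r) ] portrait σ (j + suc r) (z ++ s)) ≡ false
    balanced z = trans (sym (xorSum-cong (allWords (suc r)) (↾-++ (portrait σ) z (suc r))))
      (InM⇒sgnBit≡false ℓ σ σ∈M j z)
    cousins : (⨁[ w ∈ allWords j ] (⨁[ t ∈ allWords r ] portrait σ (j + suc r) (w ++ false ∷ t))) ≡ false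
    cousins = trans (xorSum-cong (allWords j) λ w → sym (trans (InM-negBit r σ σ∈M w)
      (xorSum-cong (allWords r) λ t → trans (↾-∷ʳ (portrait σ) w false r t) (↾-++ (portrait σ) w (suc r) (false ∷ t)))))
      ψBit≡0

  ψ≡1⇒ψBit≡false : ∀ σ → ψ ℓ n σ ≡ replicate n ⊕ → ∀ L → L < n → ψBit ℓ (suc L) σ ≡ false
  ψ≡1⇒ψBit≡false σ ψ≡1 L L<n = subst (λ L → ψBit ℓ (suc L) σ ≡ false) (FinP.toℕ-fromℕ< L<n)
    (bitSign≡⊕⇒false (begin
      bitSign (ψBit ℓ (suc (toℕ i)) σ)                                ≡⟨ Vec.lookup∘tabulate _ i ⟨
      lookup (tabulate (λ j → bitSign (ψBit ℓ (suc (toℕ j)) σ))) i    ≡⟨ cong (λ v → lookup v i) (ψ≡tabulate-ψBit ℓ n σ) ⟨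
      lookup (ψ ℓ n σ) i                                              ≡⟨ cong (λ v → lookup v i) ψ≡1 ⟩
      lookup (replicate n ⊕) i                                        ≡⟨ Vec.lookup-replicate i ⊕ ⟩
      ⊕                                                               ∎))
    where
    open ≡-Reasoning
    i = Fin.fromℕ< L<n

  ψ≡1⇒InCommutator : ∀ σ → InM ℓ σ → ψ ℓ n σ ≡ replicate n ⊕ → InCommutator ℓ n σ
  ψ≡1⇒InCommutator σ σ∈M ψ≡1 = InCommutator-resp-≈
    (InCommutator-truncate (portrait σ) n λ L L<n → InCommutatorSlice-level σ L σ∈M (ψ≡1⇒ψBit≡false σ ψ≡1 L L<n))
    (≈-truncate n σ)

-- Surjectivity

isZeros : ∀ {m} → Word m → Bool
isZeros v = v == replicate _ false

isZeros-∷ : ∀ {m} b (v : Word m) → isZeros (b ∷ v) ≡ not b ∧ isZeros v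
isZeros-∷ b v = trans (==-++ (b ∷ []) (false ∷ []) v _) (cong (_∧ isZeros v) (first b))
  where
  first : ∀ b → (b ∷ []) == (false ∷ []) ≡ not b
  first false = ==-refl (false ∷ [])
  first true  = dec-false ((true ∷ []) ≟ᵂ (false ∷ [])) λ ()

zerosExcept : ∀ {m} → ℕ → Word m → Bool
zerosExcept p       []      = true
zerosExcept zero    (b ∷ v) = isZeros v
zerosExcept (suc p) (b ∷ v) = not b ∧ zerosExcept p v

zerosExcept-++ : ∀ {j m} (w : Word j) c (t : Word m) → zerosExcept j (w ++ c ∷ t) ≡ isZeros w ∧ isZeros t
zerosExcept-++ []      c t = refl
zerosExcept-++ (b ∷ w) c t = trans (cong (not b ∧_) (zerosExcept-++ w c t))
  (trans (sym (∧-assoc (not b) _ _)) (cong (_∧ isZeros t) (sym (isZeros-∷ b w))))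

signAt : ∀ {n} → Vec Sign n → ℕ → Sign
signAt []      _       = ⊕
signAt (s ∷ e) zero    = s
signAt (s ∷ e) (suc k) = signAt e k

signAt-toℕ : ∀ {n} (e : Vec Sign n) (j : Fin n) → signAt e (toℕ j) ≡ lookup e j
signAt-toℕ (s ∷ e) Fin.zero    = refl
signAt-toℕ (s ∷ e) (Fin.suc j) = signAt-toℕ e j

-- The witness for e flips, on level L, the node 0…0 if L < ℓ − 1, and otherwise
-- the two cousins 0…0 c 0…0 (c at position L − (ℓ − 1)), exactly when e_{L+1} = −1.
module Surjectivity (r n : ℕ) (e : Vec Sign n) where
  private ℓ = suc (suc r)

  marked : ∀ L → Word L → Bool
  marked L v = if L <ᵇ suc r then isZeros v else zerosExcept (L ∸ suc r) v

  witnessPortrait : Portrait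
  witnessPortrait L v = isMinus (signAt e L) ∧ marked L v

  witness : TreeAut
  witness = fromPortrait witnessPortrait

  marked-high : ∀ k (v : Word (k + suc r)) → marked (k + suc r) v ≡ zerosExcept k v
  marked-high k v = trans
    (cong (λ b → if b then isZeros v else zerosExcept (k + suc r ∸ suc r) v)
      (≮⇒<ᵇ≡false λ lt → ℕ.<-irrefl refl (ℕ.<-≤-trans lt (ℕ.m≤n+m (suc r) k))))
    (cong (λ p → zerosExcept p v) (ℕ.m+n∸n≡m k (suc r)))

  witness-InM : InM ℓ witness
  witness-InM = InM-fromPortrait r witnessPortrait λ k z →
    trans (xorSum-∧ˡ (allWords (suc r)) (isMinus (signAt e (k + suc r))) _)
    (trans (cong (isMinus (signAt e (k + suc r)) ∧_) (begin
      (⨁[ t ∈ allWords (suc r) ] marked (k + suc r) (z ++ t))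
        ≡⟨ xorSum-cong (allWords (suc r)) (λ t → marked-high k (z ++ t)) ⟩
      (⨁[ t ∈ allWords (suc r) ] zerosExcept k (z ++ t))
        ≡⟨ ⨁-allWords-suc r _ ⟩
      (⨁[ t ∈ allWords r ] zerosExcept k (z ++ false ∷ t)) xor (⨁[ t ∈ allWords r ] zerosExcept k (z ++ true ∷ t))
        ≡⟨ cong₂ _xor_ (xorSum-cong (allWords r) (zerosExcept-++ z false)) (xorSum-cong (allWords r) (zerosExcept-++ z true)) ⟩
      (⨁[ t ∈ allWords r ] (isZeros z ∧ isZeros t)) xor (⨁[ t ∈ allWords r ] (isZeros z ∧ isZeros t))
        ≡⟨ xor-same (⨁[ t ∈ allWords r ] (isZeros z ∧ isZeros t)) ⟩
      false ∎))
    (∧-zeroʳ _))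
    where open ≡-Reasoning

  ⨁-isZeros : ∀ m → xorSum (allWords m) isZeros ≡ true
  ⨁-isZeros m = ⨁-allWords-== m (replicate m false)

  ψBit-witness : ∀ L → ψBit ℓ (suc L) witness ≡ isMinus (signAt e L)
  ψBit-witness L with L <ᵇ suc r in below
  ... | true  = begin
    (⨁[ v ∈ allWords L ] portrait witness L v)
      ≡⟨ xorSum-cong (allWords L) (portrait-fromPortrait witnessPortrait L) ⟩
    (⨁[ v ∈ allWords L ] (isMinus (signAt e L) ∧ marked L v))
      ≡⟨ xorSum-∧ˡ (allWords L) _ _ ⟩
    isMinus (signAt e L) ∧ (⨁[ v ∈ allWords L ] marked L v)
      ≡⟨ cong (isMinus (signAt e L) ∧_) (trans (xorSum-cong (allWords L) λ v →
           cong (λ b → if b then isZeros v else zerosExcept (L ∸ suc r) v) below) (⨁-isZeros L)) ⟩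
    isMinus (signAt e L) ∧ true
      ≡⟨ ∧-identityʳ _ ⟩
    isMinus (signAt e L) ∎
    where open ≡-Reasoning
  ... | false = begin
    (⨁[ w ∈ allWords j ] negBit ℓ witness w)
      ≡⟨ xorSum-cong (allWords j) cousin-block ⟩
    (⨁[ w ∈ allWords j ] (m ∧ isZeros w))
      ≡⟨ xorSum-∧ˡ (allWords j) m isZeros ⟩
    m ∧ xorSum (allWords j) isZeros
      ≡⟨ cong (m ∧_) (⨁-isZeros j) ⟩
    m ∧ true
      ≡⟨ ∧-identityʳ m ⟩
    m
      ≡⟨ cong (λ L → isMinus (signAt e L)) (ℕ.m∸n+n≡m (<ᵇ≡false⇒≥ {L} {suc r} below)) ⟩
    isMinus (signAt e L) ∎
    where
    open ≡-Reasoning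
    j = L ∸ suc r
    m = isMinus (signAt e (j + suc r))
    cousin-block : ∀ w → negBit ℓ witness w ≡ m ∧ isZeros w
    cousin-block w = begin
      negBit ℓ witness w
        ≡⟨ InM-negBit r witness witness-InM w ⟩
      (⨁[ t ∈ allWords r ] (portrait witness ↾ (w ∷ʳ false)) r t)
        ≡⟨ xorSum-cong (allWords r) (λ t → trans (↾-∷ʳ (portrait witness) w false r t)
             (trans (↾-++ (portrait witness) w (suc r) (false ∷ t)) (portrait-fromPortrait witnessPortrait _ _))) ⟩
      (⨁[ t ∈ allWords r ] (m ∧ marked (j + suc r) (w ++ false ∷ t)))
        ≡⟨ xorSum-∧ˡ (allWords r) m _ ⟩
      m ∧ (⨁[ t ∈ allWords r ] marked (j + suc r) (w ++ false ∷ t))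
        ≡⟨ cong (m ∧_) (xorSum-cong (allWords r) λ t → trans (marked-high j (w ++ false ∷ t)) (zerosExcept-++ w false t)) ⟩
      m ∧ (⨁[ t ∈ allWords r ] (isZeros w ∧ isZeros t))
        ≡⟨ cong (m ∧_) (trans (xorSum-∧ˡ (allWords r) (isZeros w) isZeros)
             (trans (cong (isZeros w ∧_) (⨁-isZeros r)) (∧-identityʳ _))) ⟩
      m ∧ isZeros w ∎

  ψ-witness : ψ ℓ n witness ≡ e
  ψ-witness = trans (ψ≡tabulate-ψBit ℓ n witness) (trans (Vec.tabulate-cong λ j →
    trans (cong bitSign (ψBit-witness (toℕ j))) (trans (bitSign-isMinus _) (signAt-toℕ e j)))
    (Vec.tabulate∘lookup e))

open import Data.Sign using (+)

theorem5p5 : ∀ (ℓ n : ℕ) → 2 ≤ ℓ →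
      -- ψ_n is well defined on M_{ℓ,n} (depends only on the restriction to T_n)
      (∀ σ τ → InM ℓ σ → InM ℓ τ → σ ≈[ n ] τ → ψ ℓ n σ ≡ ψ ℓ n τ)
      -- ψ_n is a group homomorphism into {±1}^n
    × (∀ σ τ → InM ℓ σ → InM ℓ τ → ψ ℓ n (σ ∘ᵀ τ) ≡ zipWith _*_ (ψ ℓ n σ) (ψ ℓ n τ))
      -- ψ_n is surjective
    × (∀ (e : Vec Sign n) → ∃ λ σ → InM ℓ σ × ψ ℓ n σ ≡ e)
      -- ker ψ_n is the commutator subgroup of M_{ℓ,n}
    × (∀ σ → InM ℓ σ → (ψ ℓ n σ ≡ replicate n + ⇔ InCommutator ℓ n σ))
theorem5p5 (suc (suc r)) n (s≤s (s≤s z≤n)) =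
    (λ σ τ _ _ → ψ-restrict r n σ τ)
  , (λ σ τ → ψ-∘ᵀ r n σ τ)
  , (λ e → witness e , witness-InM e , ψ-witness e)
  , (λ σ σ∈M → mk⇔ (ψ≡1⇒InCommutator σ σ∈M) (InCommutator⇒ψ≡1 r n σ))
  where
  open Surjectivity r n using (witness; witness-InM; ψ-witness)
  open Generators r n using (ψ≡1⇒InCommutator)
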